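{- For all sums of expressions $\mathbb A,\mathbb B$ of the $\partial_0\lambda$-calculus with tests and every repetition-free list $\vec x$ of variables containing the free variables of $\mathbb A$: if $\mathbb A\twoheadrightarrow\mathbb B$ then $\llbracket\mathbb A\rrbracket_{\vec x}=\llbracket\mathbb B\rrbracket_{\vec x}$.
   Context: Syntax of the $\partial_0\lambda$-calculus with tests. Terms $M,N,L$, bags $P$ and tests $V,W$ are given by $M ::= x \mid \lambda x.M \mid MP \mid \bar\tau(V)$, $P ::= [L_1,\dots,L_k]$, $V ::= \tau[L_1,\dots,L_k]$ ($k\ge 0$), finite multisets of terms (the tag $\tau$ distinguishes tests from bags); expressions are taken up to $\alpha$-equivalence. $\uplus$ is union of bags; $\varepsilon:=\tau[\,]$ and $V\mid W$ is multiset union of tests. Sums (of each sort) are finite formal sums with idempotent addition, $0$ the empty sum; constructors extend multilinearly to sums (e.g. $\lambda x.\sum_iM_i=\sum_i\lambda x.M_i$, $(\sum_iM_i)(\sum_jP_j)=\sum_{i,j}M_iP_j$, $[\sum_iL_i]\uplus P=\sum_i[L_i]\uplus P$, $\tau[\sum_iM_i]\mid V=\sum_i\tau[M_i]\mid V$), and give $0$ when applied to $0$. $A\{0/x\}=0$ if $x$ is free in $A$, else $A$. Linear substitution: $x\langle N/x\rangle=N$; $y\langle N/x\rangle=0$ ($y\ne x$); $(\lambda y.M)\langle N/x\rangle=\lambda y.M\langle N/x\rangle$; $(MP)\langle N/x\rangle=M\langle N/x\rangle P+M(P\langle N/x\rangle)$; $\bar\tau(V)\langle N/x\rangle=\bar\tau(V\langle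 N/x\rangle)$; $[L_1,\dots,L_k]\langle N/x\rangle=\sum_i[L_1,\dots,L_i\langle N/x\rangle,\dots,L_k]$, likewise for tests. For $P=[L_1,\dots,L_k]$, $x$ not free in $P$, $A\langle P/x\rangle:=A\langle L_1/x\rangle\cdots\langle L_k/x\rangle$. Reduction: $(\lambda x.M)P\to M\langle P/x\rangle\{0/x\}$; $\bar\tau(V)P\to\bar\tau(V)$ if $P=[\,]$, else $\to0$; $\tau[\lambda x.M]\mid V\to\tau[M\{0/x\}]\mid V$; $\tau[\bar\tau(V)]\mid W\to V\mid W$; $\to$ is the closure under all syntactic positions and sums, $\twoheadrightarrow$ its reflexive-transitive closure. The model $\mathcal D$. $\mathcal M_f(S)$ = finite multisets over $S$. $D_0=\emptyset$, $D_{n+1}$ = $\mathbb N$-indexed sequences $(a_1,a_2,\dots)$ of elements of $\mathcal M_f(D_n)$ with all but finitely many empty; $\mathcal D=\bigcup_nD_n$; $a::(a_1,a_2,\dots):=(a,a_1,a_2,\dots)$; $*:=([\,],[\,],\dots)$; $\uplus$ on tuples is componentwise. For a repetition-free list $\vec x=x_1,\dots,x_n$ containing the free variables, $\llbracket M\rrbracket_{\vec x}\subseteq\mathcal M_f(\mathcal D)^n\times\mathcal D$, $\llbracket P\rrbracket_{\vec x}\subseteq\mathcal M_f(\mathcal D)^n\times\mathcal M_f(\mathcal D)$, $\llbracket V\rrbracket_{\vec x}\subseteq\mathcal M_f(\mathcal D)^n$: $\llbracket x_i\rrbracket_{\vec x}=\{(([\,],\dots,[\alpha],\dots,[\,]),\alpha):\alpha\in\mathcal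 D\}$ ($[\alpha]$ in position $i$); $\llbracket\lambda y.M\rrbracket_{\vec x}=\{(\vec a,b::\alpha):((\vec a,b),\alpha)\in\llbracket M\rrbracket_{\vec x,y}\}$; $\llbracket MP\rrbracket_{\vec x}=\{(\vec a_1\uplus\vec a_2,\alpha):\exists b\,(\vec a_1,b::\alpha)\in\llbracket M\rrbracket_{\vec x},(\vec a_2,b)\in\llbracket P\rrbracket_{\vec x}\}$; $\llbracket\bar\tau(V)\rrbracket_{\vec x}=\{(\vec a,*):\vec a\in\llbracket V\rrbracket_{\vec x}\}$; $\llbracket[L_1,\dots,L_k]\rrbracket_{\vec x}=\{(\biguplus_i\vec a_i,[\beta_1,\dots,\beta_k]):(\vec a_i,\beta_i)\in\llbracket L_i\rrbracket_{\vec x}\}$; $\llbracket\tau[L_1,\dots,L_k]\rrbracket_{\vec x}=\{\biguplus_i\vec a_i:(\vec a_i,*)\in\llbracket L_i\rrbracket_{\vec x}\}$; a sum is interpreted as the union of the interpretations of its summands. -}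

module Defs where

open import Data.Nat using (ℕ; zero; suc; pred; _≡ᵇ_; _<ᵇ_)
open import Data.Bool using (Bool; true; false; if_then_else_; _∨_; T)
open import Data.Fin using (Fin)
open import Data.List using (List; []; _∷_; _++_; map; concatMap; replicate; zipWith; length; lookup; [_])
open import Data.List.Membership.Propositional using (_∈_)
open import Data.List.Relation.Unary.Any using (Any)
open import Data.List.Relation.Binary.Pointwise using (Pointwise)
open import Data.Product using (Σ; _×_; ∃)
open import Data.Sum using (_⊎_)
open import Data.Unit using (⊤)
open import Relation.Binary.PropositionalEquality using (_≡_)
open import Relation.Binary.Construct.Closure.ReflexiveTransitive using (Star)

-- Syntax (de Bruijn indices; α-equivalence is syntactic identity).
-- Bags and tests are both represented by lists of terms (multisets up to
-- permutation, see _≅L_ below); the tag τ is the constructor 'tst'.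

data Tm : Set where
  var : ℕ → Tm
  lam : Tm → Tm
  app : Tm → List Tm → Tm
  tst : List Tm → Tm

data Sort : Set where
  term bag test : Sort

Ex : Sort → Set
Ex term = Tm
Ex bag  = List Tm
Ex test = List Tm

-- sums = finite formal sums, represented as lists (idempotence and
-- commutativity handled by the equivalence _≈Σ_ below)
Sum : Sort → Set
Sum s = List (Ex s)

-- Structural equivalence: bags/tests are multisets (permutation).

mutual
  data _≅T_ : Tm → Tm → Set where
    var : ∀ {i} → var i ≅T var i
    lam : ∀ {M M'} → M ≅T M' → lam M ≅T lam M'
    app : ∀ {M M' P P'} → M ≅T M' → P ≅L P' → app M P ≅T app M' P'
    tst : ∀ {V V'} → V ≅L V' → tst V ≅T tst V'

  data _≅L_ : List Tm → List Tm → Set where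
    []  : [] ≅L []
    pick : ∀ {L Ls K Ks1 Ks2 Ks} → Ks ≡ Ks1 ++ K ∷ Ks2 →
           L ≅T K → Ls ≅L (Ks1 ++ Ks2) → (L ∷ Ls) ≅L Ks

_≅_ : {s : Sort} → Ex s → Ex s → Set
_≅_ {term} = _≅T_
_≅_ {bag}  = _≅L_
_≅_ {test} = _≅L_

-- equality of sums (as sets of summands up to ≅; addition idempotent)
_≈Σ_ : {s : Sort} → Sum s → Sum s → Set
_≈Σ_ {s} S T = (∀ {A} → A ∈ S → ∃ λ B → B ∈ T × _≅_ {s} A B)
             × (∀ {B} → B ∈ T → ∃ λ A → A ∈ S × _≅_ {s} A B)

mutual
  freeT : ℕ → Tm → Bool
  freeT i (var j)   = j ≡ᵇ i
  freeT i (lam M)   = freeT (suc i) M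
  freeT i (app M P) = freeT i M ∨ freeL i P
  freeT i (tst V)   = freeL i V

  freeL : ℕ → List Tm → Bool
  freeL i []       = false
  freeL i (L ∷ Ls) = freeT i L ∨ freeL i Ls

Free : (s : Sort) → ℕ → Ex s → Bool
Free term = freeT
Free bag  = freeL
Free test = freeL

FreeΣ : (s : Sort) → ℕ → Sum s → Set
FreeΣ s i S = Any (λ A → T (Free s i A)) S

mutual
  shiftT : ℕ → Tm → Tm
  shiftT c (var j)   = var (if j <ᵇ c then j else suc j)
  shiftT c (lam M)   = lam (shiftT (suc c) M)
  shiftT c (app M P) = app (shiftT c M) (shiftL c P)
  shiftT c (tst V)   = tst (shiftL c V)

  shiftL : ℕ → List Tm → List Tm
  shiftL c []       = []
  shiftL c (L ∷ Ls) = shiftT c L ∷ shiftL c Ls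

mutual
  -- lower indices > c by one (used when c is not free)
  lowerT : ℕ → Tm → Tm
  lowerT c (var j)   = var (if j <ᵇ c then j else pred j)
  lowerT c (lam M)   = lam (lowerT (suc c) M)
  lowerT c (app M P) = app (lowerT c M) (lowerL c P)
  lowerT c (tst V)   = tst (lowerL c V)

  lowerL : ℕ → List Tm → List Tm
  lowerL c []       = []
  lowerL c (L ∷ Ls) = lowerT c L ∷ lowerL c Ls

-- A{0/x} : 0 if x free in A, otherwise A (with x removed from the context)
erase : ℕ → Tm → List Tm
erase c M = if freeT c M then [] else [ lowerT c M ]

mutual
  lsubT : ℕ → Tm → Tm → List Tm
  lsubT k N (var j)   = if j ≡ᵇ k then [ N ] else []
  lsubT k N (lam M)   = map lam (lsubT (suc k) (shiftT 0 N) M)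
  lsubT k N (app M P) = map (λ M' → app M' P) (lsubT k N M)
                        ++ map (app M) (lsubL k N P)
  lsubT k N (tst V)   = map tst (lsubL k N V)

  lsubL : ℕ → Tm → List Tm → List (List Tm)
  lsubL k N []       = []
  lsubL k N (L ∷ Ls) = map (_∷ Ls) (lsubT k N L) ++ map (L ∷_) (lsubL k N Ls)

lsubBag : ℕ → List Tm → Tm → List Tm
lsubBag k []       M = [ M ]
lsubBag k (L ∷ Ls) M = concatMap (lsubBag k Ls) (lsubT k L M)

mutual
  data _⟶T_ : Tm → List Tm → Set where
    β    : ∀ {M P} → app (lam M) P ⟶T concatMap (erase 0) (lsubBag 0 (shiftL 0 P) M)
    τ[]  : ∀ {V} → app (tst V) [] ⟶T [ tst V ]
    τ∷   : ∀ {V L Ls} → app (tst V) (L ∷ Ls) ⟶T []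
    lamC : ∀ {M S} → M ⟶T S → lam M ⟶T map lam S
    appL : ∀ {M P S} → M ⟶T S → app M P ⟶T map (λ M' → app M' P) S
    appR : ∀ {M P S} → P ⟶B S → app M P ⟶T map (app M) S
    tstC : ∀ {V S} → V ⟶V S → tst V ⟶T map tst S

  data _⟶B_ : List Tm → List (List Tm) → Set where
    hd : ∀ {L Ls S} → L ⟶T S → (L ∷ Ls) ⟶B map (_∷ Ls) S
    tl : ∀ {L Ls S} → Ls ⟶B S → (L ∷ Ls) ⟶B map (L ∷_) S

  data _⟶V_ : List Tm → List (List Tm) → Set where
    τλ : ∀ {Ls1 M Ls2} →
         (Ls1 ++ lam M ∷ Ls2) ⟶V map (λ M' → Ls1 ++ M' ∷ Ls2) (erase 0 M)
    ττ : ∀ {Ls1 V Ls2} → (Ls1 ++ tst V ∷ Ls2) ⟶V [ Ls1 ++ V ++ Ls2 ]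
    hd : ∀ {L Ls S} → L ⟶T S → (L ∷ Ls) ⟶V map (_∷ Ls) S
    tl : ∀ {L Ls S} → Ls ⟶V S → (L ∷ Ls) ⟶V map (L ∷_) S

Red : (s : Sort) → Ex s → Sum s → Set
Red term = _⟶T_
Red bag  = _⟶B_
Red test = _⟶V_

-- one step on sums: reduce one summand, or rewrite the sum up to the
-- equational theory of sums/multisets (idempotent, commutative sums;
-- multiset bags and tests)
data Step (s : Sort) : Sum s → Sum s → Set where
  red : ∀ {S1 A S2 R} → Red s A R → Step s (S1 ++ A ∷ S2) (S1 ++ R ++ S2)
  eqv : ∀ {S T} → _≈Σ_ {s} S T → Step s S T

_↠_ : {s : Sort} → Sum s → Sum s → Set
_↠_ {s} = Star (Step s)

-- An element of D is a finitely supported sequence of finite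
-- multisets of elements of D, represented by a list (trailing empty
-- multisets irrelevant) of lists (order irrelevant); _≈D_ is the
-- identity of D on representatives.

data D : Set where
  seq : List (List D) → D

mutual
  data _≈D_ : D → D → Set where
    seq : ∀ {as bs} → as ≈Q bs → seq as ≈D seq bs

  data _≈Q_ : List (List D) → List (List D) → Set where
    []   : [] ≈Q []
    cons : ∀ {a as b bs} → a ≈M b → as ≈Q bs → (a ∷ as) ≈Q (b ∷ bs)
    padL : ∀ {bs} → [] ≈Q bs → [] ≈Q ([] ∷ bs)
    padR : ∀ {as} → as ≈Q [] → ([] ∷ as) ≈Q []

  data _≈M_ : List D → List D → Set where
    []   : [] ≈M []
    pick : ∀ {a as b bs1 bs2 bs} → bs ≡ bs1 ++ b ∷ bs2 →
           a ≈D b → as ≈M (bs1 ++ bs2) → (a ∷ as) ≈M bs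

_∷D_ : List D → D → D
a ∷D seq as = seq (a ∷ as)

star : D
star = seq []

Env : Set
Env = List (List D)

_⊎E_ : Env → Env → Env
_⊎E_ = zipWith _++_

emptyEnv : ℕ → Env
emptyEnv n = replicate n []

unitEnv : (n : ℕ) → Fin n → D → Env
unitEnv (suc n) Fin.zero    α = [ α ] ∷ emptyEnv n
unitEnv (suc n) (Fin.suc k) α = [] ∷ unitEnv n k α

-- Interpretation (membership predicates on representatives).
-- The variable list x⃗ is a list of de Bruijn indices; under a λ the
-- list becomes x⃗,y with y the newly bound index 0.

mutual
  ⟦_⟧T : Tm → List ℕ → Env → D → Set
  ⟦ var i ⟧T xs e α =
    Σ (Fin (length xs)) λ k → lookup xs k ≡ i × e ≡ unitEnv (length xs) k α
  ⟦ lam M ⟧T xs e δ =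
    Σ (List D) λ b → Σ (List (List D)) λ as →
      δ ≡ seq (b ∷ as) × ⟦ M ⟧T (map suc xs ++ [ 0 ]) (e ++ [ b ]) (seq as)
  ⟦ app M P ⟧T xs e α =
    Σ Env λ e1 → Σ Env λ e2 → Σ (List D) λ b → Σ D λ γ →
      e ≡ e1 ⊎E e2 × ⟦ M ⟧T xs e1 γ × γ ≈D (b ∷D α) × ⟦ P ⟧B xs e2 b
  ⟦ tst V ⟧T xs e α = ⟦ V ⟧V xs e × α ≡ star

  ⟦_⟧B : List Tm → List ℕ → Env → List D → Set
  ⟦ [] ⟧B xs e bb = e ≡ emptyEnv (length xs) × bb ≡ []
  ⟦ L ∷ Ls ⟧B xs e bb =
    Σ Env λ e1 → Σ Env λ e2 → Σ D λ b → Σ (List D) λ bs →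
      e ≡ e1 ⊎E e2 × bb ≡ b ∷ bs × ⟦ L ⟧T xs e1 b × ⟦ Ls ⟧B xs e2 bs

  ⟦_⟧V : List Tm → List ℕ → Env → Set
  ⟦ [] ⟧V xs e = e ≡ emptyEnv (length xs)
  ⟦ L ∷ Ls ⟧V xs e =
    Σ Env λ e1 → Σ Env λ e2 → Σ D λ γ →
      e ≡ e1 ⊎E e2 × ⟦ L ⟧T xs e1 γ × γ ≈D star × ⟦ Ls ⟧V xs e2

-- the "output" component of the interpretation of each sort
Pt : Sort → Set
Pt term = D
Pt bag  = List D
Pt test = ⊤

_≈P_ : {s : Sort} → Pt s → Pt s → Set
_≈P_ {term} = _≈D_
_≈P_ {bag}  = _≈M_
_≈P_ {test} = λ _ _ → ⊤

⟦_⟧ : {s : Sort} → Ex s → List ℕ → Env → Pt s → Set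
⟦_⟧ {term} A xs e p = ⟦ A ⟧T xs e p
⟦_⟧ {bag}  A xs e p = ⟦ A ⟧B xs e p
⟦_⟧ {test} A xs e p = ⟦ A ⟧V xs e

⟦_⟧Σ : {s : Sort} → Sum s → List ℕ → Env → Pt s → Set
⟦ S ⟧Σ xs e p = Any (λ A → ⟦ A ⟧ xs e p) S

-- equality of interpretations as subsets of M_f(D)^n × (output),
-- i.e. equality of the images under the identification _≈D_
_≐_ : {s : Sort} → (Env → Pt s → Set) → (Env → Pt s → Set) → Set
_≐_ {s} X Y =
  (∀ e p → X e p → Σ Env λ e' → Σ (Pt s) λ p' →
             Pointwise _≈M_ e e' × _≈P_ {s} p p' × Y e' p')
  × (∀ e p → Y e p → Σ Env λ e' → Σ (Pt s) λ p' →
             Pointwise _≈M_ e e' × _≈P_ {s} p p' × X e' p')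

-- Each reduction step preserves the interpretation up to the identification ≈ of
-- representatives, and both inclusions compose along ↠.  Contextual closure is
-- uniform: every constructor is a frame, whose points contain a point of the hole
-- that may be replaced by any nearby point of another expression.  For β the key
-- is the substitution lemma: a point of M⟨N/x⟩ is a point of M one of whose
-- x-values δ is traded for a point of N of value δ, environments being added.
-- Iterating over the bag consumes the multiset of x exactly, leaving it empty, and
-- a variable with empty multiset can be erased (strengthening), which is M{0/x}.
-- The test rules hold because a test is a bag all of whose values are ≈ ⋆, and
-- structural equivalence because bag interpretations are invariant under permutation.

module Submission where

open import Defs
open import Data.Bool using (true; false; if_then_else_; _∨_; T)
open import Data.Empty using (⊥; ⊥-elim)
open import Data.Fin using (Fin) renaming (zero to fzero; suc to fsuc)
open import Data.List using (List; []; _∷_; _++_; [_]; length; map; lookup; concatMap)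
open import Data.List.Properties using (++-assoc; ++-identityʳ; ++-conicalˡ; ++-conicalʳ; ∷-injective; length-++; length-map; length-replicate)
open import Data.List.Membership.Propositional using (_∈_; find; lose)
open import Data.List.Membership.Propositional.Properties using (∈-map⁺; ∈-map⁻; ∈-++⁺ˡ; ∈-++⁺ʳ; ∈-++⁻; ∈-concatMap⁺; ∈-concatMap⁻)
open import Data.List.Relation.Binary.Pointwise using (Pointwise; []; _∷_; Pointwise-length)
import Data.List.Relation.Binary.Pointwise as Pointwise
open import Data.List.Relation.Unary.All using (All; []; _∷_)
import Data.List.Relation.Unary.All.Properties as All
open import Data.List.Relation.Unary.Any using (here)
import Data.List.Relation.Unary.Any.Properties as Any
open import Data.List.Relation.Unary.Unique.Propositional using (Unique)
open import Data.Nat using (ℕ; zero; suc; pred; _<_; z<s; s<s; _≡ᵇ_; _<ᵇ_)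
open import Data.Nat.Properties using (suc-injective; +-comm; ≡ᵇ⇒≡; ≡⇒≡ᵇ)
open import Data.Product using (Σ; _×_; _,_; ∃; proj₁; proj₂)
open import Data.Sum using (_⊎_; inj₁; inj₂)
open import Data.Unit using (tt)
open import Relation.Binary.PropositionalEquality using (_≡_; _≢_; refl; sym; trans; cong; cong₂; subst)
open import Relation.Binary.Construct.Closure.ReflexiveTransitive using (ε; _◅_)

split-++ : ∀ {A : Set} (a b c : List A) x d → a ++ b ≡ c ++ x ∷ d →
  (∃ λ u → a ≡ c ++ x ∷ u × d ≡ u ++ b) ⊎ (∃ λ u → b ≡ u ++ x ∷ d × c ≡ a ++ u)
split-++ []       b c        x d eq = inj₂ (c , eq , refl)
split-++ (a ∷ as) b []       x d eq with ∷-injective eq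
... | refl , refl = inj₁ (as , refl , refl)
split-++ (a ∷ as) b (c ∷ cs) x d eq with ∷-injective eq
... | refl , eq′ with split-++ as b cs x d eq′
... | inj₁ (u , p , q) = inj₁ (u , cong (c ∷_) p , q)
... | inj₂ (u , p , q) = inj₂ (u , p , cong (c ∷_) q)

++∷≢[] : ∀ {A : Set} (xs : List A) {y ys} → xs ++ y ∷ ys ≡ [] → ⊥
++∷≢[] xs eq with ++-conicalʳ xs _ eq
... | ()

∷ʳ-split : ∀ {A B : Set} (xs : List A) {y} (E : List B) → length E ≡ length (xs ++ [ y ]) →
  Σ (List B) λ E₀ → Σ B λ c → E ≡ E₀ ++ [ c ] × length E₀ ≡ length xs
∷ʳ-split []       (c ∷ []) _ = [] , c , refl , refl
∷ʳ-split (_ ∷ xs) (d ∷ E)  l with ∷ʳ-split xs E (suc-injective l)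
... | E₀ , c , refl , l₀ = d ∷ E₀ , c , refl , cong suc l₀

length-∷ʳ-injective : ∀ {A B : Set} (a : List A) (b : List B) {x y} →
  length (a ++ [ x ]) ≡ length (b ++ [ y ]) → length a ≡ length b
length-∷ʳ-injective a b eq = suc-injective
  (trans (trans (+-comm 1 (length a)) (sym (length-++ a)))
         (trans eq (trans (length-++ b) (+-comm (length b) 1))))

mutual
  ≈D-refl : ∀ α → α ≈D α
  ≈D-refl (seq as) = seq (≈Q-refl as)

  ≈Q-refl : ∀ as → as ≈Q as
  ≈Q-refl []       = []
  ≈Q-refl (a ∷ as) = cons (≈M-refl a) (≈Q-refl as)

  ≈M-refl : ∀ a → a ≈M a
  ≈M-refl []       = []
  ≈M-refl (α ∷ a) = pick {bs1 = []} refl (≈D-refl α) (≈M-refl a)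

≈M-cons : ∀ {α α′ a b} → α ≈D α′ → a ≈M b → (α ∷ a) ≈M (α′ ∷ b)
≈M-cons = pick {bs1 = []} refl

≈M-insert : ∀ {α α′} a₁ {a₂ b} → (a₁ ++ a₂) ≈M b → α ≈D α′ → (a₁ ++ α ∷ a₂) ≈M (α′ ∷ b)
≈M-insert []       a≈b α≈α′ = ≈M-cons α≈α′ a≈b
≈M-insert {α′ = α′} (γ ∷ a₁) (pick {bs1 = b₁} refl γ≈δ rest) α≈α′ =
  pick {bs1 = α′ ∷ b₁} refl γ≈δ (≈M-insert a₁ rest α≈α′)

mutual
  ≈D-sym : ∀ {α α′} → α ≈D α′ → α′ ≈D α
  ≈D-sym (seq p) = seq (≈Q-sym p)

  ≈Q-sym : ∀ {as bs} → as ≈Q bs → bs ≈Q as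
  ≈Q-sym []         = []
  ≈Q-sym (cons p q) = cons (≈M-sym p) (≈Q-sym q)
  ≈Q-sym (padL p)   = padR (≈Q-sym p)
  ≈Q-sym (padR p)   = padL (≈Q-sym p)

  ≈M-sym : ∀ {a b} → a ≈M b → b ≈M a
  ≈M-sym []                              = []
  ≈M-sym (pick {bs1 = b₁} refl α≈α′ rest) = ≈M-insert b₁ (≈M-sym rest) (≈D-sym α≈α′)

≈M-[]ʳ : ∀ {a} → a ≈M [] → a ≡ []
≈M-[]ʳ []                      = refl
≈M-[]ʳ (pick {bs1 = b₁} eq _ _) with ++∷≢[] b₁ (sym eq)
... | ()

≈M-[]ˡ : ∀ {a} → [] ≈M a → a ≡ []
≈M-[]ˡ [] = refl

≈M-remove : ∀ a₁ {α a₂ b} → (a₁ ++ α ∷ a₂) ≈M b →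
  Σ (List D) λ b₁ → Σ D λ α′ → Σ (List D) λ b₂ →
    b ≡ b₁ ++ α′ ∷ b₂ × α ≈D α′ × (a₁ ++ a₂) ≈M (b₁ ++ b₂)
≈M-remove [] (pick {bs1 = b₁} {b₂} eq α≈α′ rest) = b₁ , _ , b₂ , eq , α≈α′ , rest
≈M-remove (γ ∷ a₁) (pick {b = δ} {bs1 = d₁} {d₂} refl γ≈δ rest) with ≈M-remove a₁ rest
... | b₁ , α′ , b₂ , eq , α≈α′ , rest′ with split-++ d₁ d₂ b₁ α′ b₂ eq
... | inj₁ (u , refl , refl) =
  b₁ , α′ , u ++ δ ∷ d₂ , ++-assoc b₁ (α′ ∷ u) (δ ∷ d₂) , α≈α′ ,
  pick {bs1 = b₁ ++ u} (sym (++-assoc b₁ u (δ ∷ d₂))) γ≈δ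
    (subst (λ z → (a₁ ++ _) ≈M z) (sym (++-assoc b₁ u d₂)) rest′)
... | inj₂ (u , refl , refl) =
  d₁ ++ δ ∷ u , α′ , b₂ , sym (++-assoc d₁ (δ ∷ u) (α′ ∷ b₂)) , α≈α′ ,
  pick {bs1 = d₁} (++-assoc d₁ (δ ∷ u) b₂) γ≈δ
    (subst (λ z → (a₁ ++ _) ≈M z) (++-assoc d₁ u b₂) rest′)

mutual
  ≈D-trans : ∀ {α α′ γ} → α ≈D α′ → α′ ≈D γ → α ≈D γ
  ≈D-trans (seq p) (seq q) = seq (≈Q-trans p q)

  ≈Q-trans : ∀ {as bs cs} → as ≈Q bs → bs ≈Q cs → as ≈Q cs
  ≈Q-trans []         q          = q
  ≈Q-trans (cons p ps) (cons q qs) = cons (≈M-trans p q) (≈Q-trans ps qs)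
  ≈Q-trans (cons p ps) (padR qs) with ≈M-[]ʳ p
  ... | refl = padR (≈Q-trans ps qs)
  ≈Q-trans (padL ps) (cons q qs) with ≈M-[]ˡ q
  ... | refl = padL (≈Q-trans ps qs)
  ≈Q-trans (padL ps) (padR qs) = []
  ≈Q-trans (padR ps) []        = padR ps
  ≈Q-trans (padR ps) (padL qs) = cons [] (≈Q-trans ps qs)

  ≈M-trans : ∀ {a b c} → a ≈M b → b ≈M c → a ≈M c
  ≈M-trans []                              q = q
  ≈M-trans (pick {bs1 = b₁} refl α≈α′ rest) q with ≈M-remove b₁ q
  ... | _ , _ , _ , eq , α′≈γ , rest′ = pick eq (≈D-trans α≈α′ α′≈γ) (≈M-trans rest rest′)

≈M-++ : ∀ {a a′ b b′} → a ≈M a′ → b ≈M b′ → (a ++ b) ≈M (a′ ++ b′)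
≈M-++ [] q = q
≈M-++ {b′ = b′} (pick {bs1 = a₁} {a₂} refl α≈α′ rest) q =
  pick {bs1 = a₁} (++-assoc a₁ (_ ∷ a₂) b′) α≈α′
    (subst (λ z → _ ≈M z) (++-assoc a₁ a₂ b′) (≈M-++ rest q))

≈M-++-comm : ∀ a b → (a ++ b) ≈M (b ++ a)
≈M-++-comm []      b = subst (b ≈M_) (sym (++-identityʳ b)) (≈M-refl b)
≈M-++-comm (α ∷ a) b = pick {bs1 = b} refl (≈D-refl α) (≈M-++-comm a b)

≈M-swap : ∀ α α′ a → (α ∷ α′ ∷ a) ≈M (α′ ∷ α ∷ a)
≈M-swap α α′ a = pick {bs1 = [ α′ ]} refl (≈D-refl α) (≈M-cons (≈D-refl α′) (≈M-refl a))

∷D-cong : ∀ {a b} α → a ≈M b → (a ∷D α) ≈D (b ∷D α)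
∷D-cong (seq as) a≈b = seq (cons a≈b (≈Q-refl as))

infix 4 _≈E_

_≈E_ : Env → Env → Set
_≈E_ = Pointwise _≈M_

≈E-refl : ∀ {e} → e ≈E e
≈E-refl = Pointwise.refl (≈M-refl _)

≈E-sym : ∀ {e e′} → e ≈E e′ → e′ ≈E e
≈E-sym = Pointwise.symmetric ≈M-sym

≈E-trans : ∀ {e e′ e″} → e ≈E e′ → e′ ≈E e″ → e ≈E e″
≈E-trans = Pointwise.transitive ≈M-trans

≈E-reflexive : ∀ {e e′} → e ≡ e′ → e ≈E e′
≈E-reflexive refl = ≈E-refl

⊎E-cong : ∀ {a a′ b b′} → a ≈E a′ → b ≈E b′ → (a ⊎E b) ≈E (a′ ⊎E b′)
⊎E-cong []       _        = []
⊎E-cong (_ ∷ _)  []       = []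
⊎E-cong (p ∷ ps) (q ∷ qs) = ≈M-++ p q ∷ ⊎E-cong ps qs

⊎E-assoc : ∀ a b c → (a ⊎E b) ⊎E c ≡ a ⊎E (b ⊎E c)
⊎E-assoc []      b       c       = refl
⊎E-assoc (x ∷ a) []      c       = refl
⊎E-assoc (x ∷ a) (y ∷ b) []      = refl
⊎E-assoc (x ∷ a) (y ∷ b) (z ∷ c) = cong₂ _∷_ (++-assoc x y z) (⊎E-assoc a b c)

⊎E-comm : ∀ a b → (a ⊎E b) ≈E (b ⊎E a)
⊎E-comm []      []      = []
⊎E-comm []      (_ ∷ _) = []
⊎E-comm (_ ∷ _) []      = []
⊎E-comm (x ∷ a) (y ∷ b) = ≈M-++-comm x y ∷ ⊎E-comm a b

⊎E-identityˡ : ∀ e → emptyEnv (length e) ⊎E e ≡ e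
⊎E-identityˡ []      = refl
⊎E-identityˡ (x ∷ e) = cong (x ∷_) (⊎E-identityˡ e)

⊎E-identityʳ : ∀ e → e ⊎E emptyEnv (length e) ≡ e
⊎E-identityʳ []      = refl
⊎E-identityʳ (x ∷ e) = cong₂ _∷_ (++-identityʳ x) (⊎E-identityʳ e)

length-⊎E : ∀ a b → length a ≡ length b → length (a ⊎E b) ≡ length a
length-⊎E []      []      _  = refl
length-⊎E (x ∷ a) (y ∷ b) eq = cong suc (length-⊎E a b (suc-injective eq))

⊎E-length : ∀ e₁ e₂ {n} → length e₁ ≡ n → length e₂ ≡ n → length (e₁ ⊎E e₂) ≡ n
⊎E-length e₁ e₂ l₁ l₂ = trans (length-⊎E e₁ e₂ (trans l₁ (sym l₂))) l₁

⊎E-++ : ∀ a b c d → length a ≡ length b → (a ++ c) ⊎E (b ++ d) ≡ (a ⊎E b) ++ (c ⊎E d)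
⊎E-++ []      []      c d _  = refl
⊎E-++ (x ∷ a) (y ∷ b) c d eq = cong ((x ++ y) ∷_) (⊎E-++ a b c d (suc-injective eq))

⊎E-swapʳ : ∀ a b c → ((a ⊎E b) ⊎E c) ≈E ((a ⊎E c) ⊎E b)
⊎E-swapʳ a b c =
  ≈E-trans (≈E-reflexive (⊎E-assoc a b c))
    (≈E-trans (⊎E-cong (≈E-refl {a}) (⊎E-comm b c)) (≈E-reflexive (sym (⊎E-assoc a c b))))

⊎E-swapˡ : ∀ a b c → (a ⊎E (b ⊎E c)) ≈E (b ⊎E (a ⊎E c))
⊎E-swapˡ a b c =
  ≈E-trans (≈E-reflexive (sym (⊎E-assoc a b c)))
    (≈E-trans (⊎E-cong (⊎E-comm a b) (≈E-refl {c})) (≈E-reflexive (⊎E-assoc b a c)))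

≈E-∷ʳ⁻ : ∀ {e} E x → e ≈E (E ++ [ x ]) →
  Σ Env λ E′ → Σ (List D) λ x′ → e ≡ E′ ++ [ x′ ] × E′ ≈E E × x′ ≈M x
≈E-∷ʳ⁻ []      x (p ∷ []) = [] , _ , refl , [] , p
≈E-∷ʳ⁻ (y ∷ E) x (p ∷ ps) with ≈E-∷ʳ⁻ E x ps
... | E′ , x′ , refl , q , r = _ ∷ E′ , x′ , refl , p ∷ q , r

⊎E-emptyEnvˡ : ∀ {n} e → length e ≡ n → emptyEnv n ⊎E e ≡ e
⊎E-emptyEnvˡ e refl = ⊎E-identityˡ e

⊎E-emptyEnvʳ : ∀ {n} e → length e ≡ n → e ⊎E emptyEnv n ≡ e
⊎E-emptyEnvʳ e refl = ⊎E-identityʳ e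

⊎E-∷ʳ-[] : ∀ a b {x} → length a ≡ length b → (a ++ [ x ]) ⊎E (b ++ [ [] ]) ≡ (a ⊎E b) ++ [ x ]
⊎E-∷ʳ-[] a b {x} l = trans (⊎E-++ a b [ x ] [ [] ] l) (cong (λ z → (a ⊎E b) ++ [ z ]) (++-identityʳ x))

≈E-[]ˡ : ∀ {e} → [] ≈E e → e ≡ []
≈E-[]ˡ [] = refl

≈E-[]ʳ : ∀ {e} → e ≈E [] → e ≡ []
≈E-[]ʳ [] = refl

≈E-∷ʳ-injective : ∀ a b {x y} → (a ++ [ x ]) ≈E (b ++ [ y ]) → a ≈E b × x ≈M y
≈E-∷ʳ-injective []      []      (p ∷ [])  = [] , p
≈E-∷ʳ-injective []      (_ ∷ b) (_ ∷ ps) = ⊥-elim (++∷≢[] b (≈E-[]ˡ ps))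
≈E-∷ʳ-injective (_ ∷ a) []      (_ ∷ ps) = ⊥-elim (++∷≢[] a (≈E-[]ʳ ps))
≈E-∷ʳ-injective (_ ∷ a) (_ ∷ b) (p ∷ ps) with ≈E-∷ʳ-injective a b ps
... | qs , q = p ∷ qs , q

-- Near X e p: X holds at a point ≈-equivalent to (e , p).  X ⊑ Y and Y ⊑ X are
-- exactly the two halves of X ≐ Y.
Near : {s : Sort} → (Env → Pt s → Set) → Env → Pt s → Set
Near {s} X e p = Σ Env λ e′ → Σ (Pt s) λ p′ → e ≈E e′ × _≈P_ {s} p p′ × X e′ p′

_⊑_ : {s : Sort} → (Env → Pt s → Set) → (Env → Pt s → Set) → Set
X ⊑ Y = ∀ e p → X e p → Near Y e p

≈P-refl : ∀ {s} (p : Pt s) → _≈P_ {s} p p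
≈P-refl {term} = ≈D-refl
≈P-refl {bag}  = ≈M-refl
≈P-refl {test} _ = tt

≈P-trans : ∀ {s} {p q r : Pt s} → _≈P_ {s} p q → _≈P_ {s} q r → _≈P_ {s} p r
≈P-trans {term} = ≈D-trans
≈P-trans {bag}  = ≈M-trans
≈P-trans {test} _ _ = tt

near : ∀ {s} {X : Env → Pt s → Set} {e p} → X e p → Near X e p
near {s} {e = e} {p} x = e , p , ≈E-refl , ≈P-refl {s} p , x

⊑-refl : ∀ {s} {X : Env → Pt s → Set} → X ⊑ X
⊑-refl _ _ = near

⊑-trans : ∀ {s} {X Y Z : Env → Pt s → Set} → X ⊑ Y → Y ⊑ Z → X ⊑ Z
⊑-trans {s} X⊑Y Y⊑Z e p x with X⊑Y e p x
... | e′ , p′ , e≈ , p≈ , y with Y⊑Z e′ p′ y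
... | e″ , p″ , e≈′ , p≈′ , z = e″ , p″ , ≈E-trans e≈ e≈′ , ≈P-trans {s} p≈ p≈′ , z

Near-resp-≈E : ∀ {s} {X : Env → Pt s → Set} {e e′ p} → e ≈E e′ → Near X e′ p → Near X e p
Near-resp-≈E e≈e′ (e″ , p′ , e′≈ , p≈ , x) = e″ , p′ , ≈E-trans e≈e′ e′≈ , p≈ , x

Near-resp-≈ : ∀ {s} {X : Env → Pt s → Set} {e e′ p p′} →
  e ≈E e′ → _≈P_ {s} p p′ → Near X e′ p′ → Near X e p
Near-resp-≈ {s} e≈e′ p≈p′ (e″ , p″ , e′≈ , p′≈ , x) =
  e″ , p″ , ≈E-trans e≈e′ e′≈ , ≈P-trans {s} p≈p′ p′≈ , x

Near-map : ∀ {s} {X Y : Env → Pt s → Set} {e p} → (∀ {e p} → X e p → Y e p) → Near X e p → Near Y e p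
Near-map f (e′ , p′ , e≈ , p≈ , x) = e′ , p′ , e≈ , p≈ , f x

Near-lose : ∀ {s} {S : Sum s} {A xs e p} → A ∈ S → Near {s} (⟦ A ⟧ xs) e p → Near (⟦ S ⟧Σ xs) e p
Near-lose m (e′ , p′ , e≈ , p≈ , h) = e′ , p′ , e≈ , p≈ , lose m h

Near-find : ∀ {s} {S : Sum s} {xs e p} → Near (⟦ S ⟧Σ xs) e p →
  Σ (Ex s) λ A → A ∈ S × Near {s} (⟦ A ⟧ xs) e p
Near-find (e′ , p′ , e≈ , p≈ , h) with find h
... | A , m , hA = A , m , e′ , p′ , e≈ , p≈ , hA

⟦_⟧TΣ : List Tm → List ℕ → Env → D → Set
⟦_⟧TΣ = ⟦_⟧Σ {term}

⟦_⟧BΣ : List (List Tm) → List ℕ → Env → List D → Set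
⟦_⟧BΣ = ⟦_⟧Σ {bag}

_⊑T_ : (Env → D → Set) → (Env → D → Set) → Set
_⊑T_ = _⊑_ {term}

_⊑B_ : (Env → List D → Set) → (Env → List D → Set) → Set
_⊑B_ = _⊑_ {bag}

⟦_⟧VΣ : List (List Tm) → List ℕ → Env → Set
⟦ S ⟧VΣ xs e = ⟦_⟧Σ {test} S xs e tt

_⊑V_ : (Env → Set) → (Env → Set) → Set
X ⊑V Y = _⊑_ {test} (λ e _ → X e) (λ e _ → Y e)

IsStar : List D → Set
IsStar = All (_≈D star)

⟦⟧V⇒⟦⟧B : ∀ V {xs e} → ⟦ V ⟧V xs e → Σ (List D) λ b → ⟦ V ⟧B xs e b × IsStar b
⟦⟧V⇒⟦⟧B []       h = [] , (h , refl) , []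
⟦⟧V⇒⟦⟧B (L ∷ Ls) (e₁ , e₂ , γ , eq , h₁ , γ≈⋆ , h₂) with ⟦⟧V⇒⟦⟧B Ls h₂
... | b , hb , ⋆s = γ ∷ b , (e₁ , e₂ , γ , b , eq , refl , h₁ , hb) , γ≈⋆ ∷ ⋆s

⟦⟧B⇒⟦⟧V : ∀ V {xs e b} → ⟦ V ⟧B xs e b → IsStar b → ⟦ V ⟧V xs e
⟦⟧B⇒⟦⟧V []       (h , _) _ = h
⟦⟧B⇒⟦⟧V (L ∷ Ls) (e₁ , e₂ , γ , b , eq , refl , h₁ , h₂) (γ≈⋆ ∷ ⋆s) =
  e₁ , e₂ , γ , eq , h₁ , γ≈⋆ , ⟦⟧B⇒⟦⟧V Ls h₂ ⋆s

IsStar-resp-≈M : ∀ {a b} → a ≈M b → IsStar b → IsStar a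
IsStar-resp-≈M []                              _  = []
IsStar-resp-≈M (pick {bs1 = b₁} refl α≈α′ rest) ps with All.++⁻ b₁ ps
... | qs , (r ∷ rs) = ≈D-trans α≈α′ r ∷ IsStar-resp-≈M rest (All.++⁺ qs rs)

length-unitEnv : ∀ n (k : Fin n) α → length (unitEnv n k α) ≡ n
length-unitEnv (suc n) fzero    α = cong suc (length-replicate n)
length-unitEnv (suc n) (fsuc k) α = cong suc (length-unitEnv n k α)

mutual
  ⟦⟧T-length : ∀ M {xs e α} → ⟦ M ⟧T xs e α → length e ≡ length xs
  ⟦⟧T-length (var i)   (k , _ , refl)            = length-unitEnv _ k _
  ⟦⟧T-length (lam M) {xs} {e} (b , _ , _ , h)     =
    trans (length-∷ʳ-injective e (map suc xs) (⟦⟧T-length M h)) (length-map suc xs)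
  ⟦⟧T-length (app M P) (e₁ , e₂ , _ , _ , refl , h₁ , _ , h₂) =
    ⊎E-length e₁ e₂ (⟦⟧T-length M h₁) (⟦⟧B-length P h₂)
  ⟦⟧T-length (tst V)   (h , _)                     = ⟦⟧B-length V (proj₁ (proj₂ (⟦⟧V⇒⟦⟧B V h)))

  ⟦⟧B-length : ∀ P {xs e b} → ⟦ P ⟧B xs e b → length e ≡ length xs
  ⟦⟧B-length []       (refl , _) = length-replicate _
  ⟦⟧B-length (L ∷ Ls) (e₁ , e₂ , _ , _ , refl , _ , h₁ , h₂) =
    ⊎E-length e₁ e₂ (⟦⟧T-length L h₁) (⟦⟧B-length Ls h₂)

⟦⟧V-length : ∀ V {xs e} → ⟦ V ⟧V xs e → length e ≡ length xs
⟦⟧V-length V h = ⟦⟧B-length V (proj₁ (proj₂ (⟦⟧V⇒⟦⟧B V h)))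

⟦⟧T-length-under-λ : ∀ M {xs E c α} → ⟦ M ⟧T (map suc xs ++ [ 0 ]) (E ++ [ c ]) α → length E ≡ length xs
⟦⟧T-length-under-λ M {xs} {E} h =
  trans (length-∷ʳ-injective E (map suc xs) (⟦⟧T-length M h)) (length-map suc xs)

infix 4 _[_]=_

data _[_]=_ {A : Set} : List A → ℕ → A → Set where
  here  : ∀ {x xs} → (x ∷ xs) [ zero ]= x
  there : ∀ {x y xs n} → xs [ n ]= x → (y ∷ xs) [ suc n ]= x

[]=-<length : ∀ {A : Set} {xs : List A} {n x} → xs [ n ]= x → n < length xs
[]=-<length here      = z<s
[]=-<length (there p) = s<s ([]=-<length p)

[]=-under-λ : ∀ {xs n k} → xs [ n ]= k → (map suc xs ++ [ 0 ]) [ n ]= suc k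
[]=-under-λ here      = here
[]=-under-λ (there p) = there ([]=-under-λ p)

[]=-bound : ∀ xs → (map suc xs ++ [ 0 ]) [ length xs ]= 0
[]=-bound []       = here
[]=-bound (_ ∷ xs) = there ([]=-bound xs)

data Pick : ℕ → Env → D → Env → Set where
  here  : ∀ {s s′ e α} s₁ s₂ → s ≡ s₁ ++ α ∷ s₂ → s′ ≡ s₁ ++ s₂ → Pick zero (s ∷ e) α (s′ ∷ e)
  there : ∀ {n s e α r} → Pick n e α r → Pick (suc n) (s ∷ e) α (s ∷ r)

Pick-length : ∀ {n e α r} → Pick n e α r → length r ≡ length e
Pick-length (here _ _ _ _) = refl
Pick-length (there p)      = cong suc (Pick-length p)

Pick-∷ʳ : ∀ {n e α r c} → Pick n e α r → Pick n (e ++ [ c ]) α (r ++ [ c ])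
Pick-∷ʳ (here s₁ s₂ p q) = here s₁ s₂ p q
Pick-∷ʳ (there p)        = there (Pick-∷ʳ p)

Pick-∷ʳ⁻ : ∀ e {n α r c} → Pick n (e ++ [ c ]) α r → n < length e →
  Σ Env λ r′ → r ≡ r′ ++ [ c ] × Pick n e α r′
Pick-∷ʳ⁻ (s ∷ e) (here s₁ s₂ p q) _         = _ ∷ e , refl , here s₁ s₂ p q
Pick-∷ʳ⁻ (s ∷ e) (there p)        (s<s n<) with Pick-∷ʳ⁻ e p n<
... | r′ , refl , p′ = s ∷ r′ , refl , there p′

Pick-last : ∀ e {n s₁ α s₂} → length e ≡ n → Pick n (e ++ [ s₁ ++ α ∷ s₂ ]) α (e ++ [ s₁ ++ s₂ ])
Pick-last []      refl = here _ _ refl refl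
Pick-last (_ ∷ e) refl = there (Pick-last e refl)

Pick-last⁻ : ∀ e {n c α r} → length e ≡ n → Pick n (e ++ [ c ]) α r →
  Σ (List D) λ s₁ → Σ (List D) λ s₂ → c ≡ s₁ ++ α ∷ s₂ × r ≡ e ++ [ s₁ ++ s₂ ]
Pick-last⁻ []      refl (here s₁ s₂ p refl) = s₁ , s₂ , p , refl
Pick-last⁻ (_ ∷ e) refl (there p) with Pick-last⁻ e refl p
... | s₁ , s₂ , eq , refl = s₁ , s₂ , eq , refl

Pick-⊎Eˡ : ∀ {n e₁ α r₁} e₂ → Pick n e₁ α r₁ → length e₁ ≡ length e₂ →
  Pick n (e₁ ⊎E e₂) α (r₁ ⊎E e₂)
Pick-⊎Eˡ (y ∷ e₂) (here s₁ s₂ refl refl) _ = here s₁ (s₂ ++ y) (++-assoc s₁ _ y) (++-assoc s₁ s₂ y)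
Pick-⊎Eˡ (y ∷ e₂) (there p)              l = there (Pick-⊎Eˡ e₂ p (suc-injective l))

Pick-⊎Eʳ : ∀ {n e₂ α r₂} e₁ → Pick n e₂ α r₂ → length e₁ ≡ length e₂ →
  Pick n (e₁ ⊎E e₂) α (e₁ ⊎E r₂)
Pick-⊎Eʳ (x ∷ e₁) (here s₁ s₂ refl refl) _ =
  here (x ++ s₁) s₂ (sym (++-assoc x s₁ _)) (sym (++-assoc x s₁ s₂))
Pick-⊎Eʳ (x ∷ e₁) (there p)              l = there (Pick-⊎Eʳ e₁ p (suc-injective l))

Pick-⊎E⁻ : ∀ {n α r} e₁ e₂ → Pick n (e₁ ⊎E e₂) α r →
  (Σ Env λ r₁ → Pick n e₁ α r₁ × r ≡ r₁ ⊎E e₂) ⊎ (Σ Env λ r₂ → Pick n e₂ α r₂ × r ≡ e₁ ⊎E r₂)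
Pick-⊎E⁻ (x ∷ e₁) (y ∷ e₂) (here s₁ s₂ eq refl) with split-++ x y s₁ _ s₂ eq
... | inj₁ (u , refl , refl) =
  inj₁ (_ , here s₁ u refl refl , cong (_∷ _) (sym (++-assoc s₁ u y)))
... | inj₂ (u , refl , refl) =
  inj₂ (_ , here u s₂ refl refl , cong (_∷ _) (++-assoc x u s₂))
Pick-⊎E⁻ (x ∷ e₁) (y ∷ e₂) (there p) with Pick-⊎E⁻ e₁ e₂ p
... | inj₁ (r₁ , p₁ , refl) = inj₁ (x ∷ r₁ , there p₁ , refl)
... | inj₂ (r₂ , p₂ , refl) = inj₂ (y ∷ r₂ , there p₂ , refl)

Pick-emptyEnv : ∀ {n m α r} → Pick n (emptyEnv m) α r → ⊥
Pick-emptyEnv {m = suc m} (here s₁ _ eq _) = ++∷≢[] s₁ (sym eq)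
Pick-emptyEnv {m = suc m} (there p)        = Pick-emptyEnv p

Pick-unitEnv⁻ : ∀ {xs : List ℕ} {n k α α′ r} (q : Fin (length xs)) → xs [ n ]= k →
  Pick n (unitEnv (length xs) q α) α′ r →
  lookup xs q ≡ k × α′ ≡ α × r ≡ emptyEnv (length xs)
Pick-unitEnv⁻ fzero here (here [] [] refl refl) = refl , refl , refl
Pick-unitEnv⁻ fzero here (here (_ ∷ s₁) _ eq _) = ⊥-elim (++∷≢[] s₁ (sym (proj₂ (∷-injective eq))))
Pick-unitEnv⁻ fzero here (here [] (_ ∷ _) () _)
Pick-unitEnv⁻ fzero (there _) (there p) = ⊥-elim (Pick-emptyEnv p)
Pick-unitEnv⁻ (fsuc q) here (here s₁ _ eq _) = ⊥-elim (++∷≢[] s₁ (sym eq))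
Pick-unitEnv⁻ (fsuc q) (there x) (there p) with Pick-unitEnv⁻ q x p
... | eq , refl , refl = eq , refl , refl

Pick-unitEnv : ∀ {xs : List ℕ} {n k} α → xs [ n ]= k →
  Σ (Fin (length xs)) λ q → lookup xs q ≡ k × Pick n (unitEnv (length xs) q α) α (emptyEnv (length xs))
Pick-unitEnv α here = fzero , refl , here [] [] refl refl
Pick-unitEnv α (there x) with Pick-unitEnv α x
... | q , eq , p = fsuc q , eq , there p

-- Removing a fresh variable

≡ᵇ-true⇒≡ : ∀ m n → (m ≡ᵇ n) ≡ true → m ≡ n
≡ᵇ-true⇒≡ m n eq = ≡ᵇ⇒≡ m n (subst T (sym eq) tt)

≡ᵇ-refl : ∀ n → (n ≡ᵇ n) ≡ true
≡ᵇ-refl zero    = refl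
≡ᵇ-refl (suc n) = ≡ᵇ-refl n

≡ᵇ-false⇒≢ : ∀ m n → (m ≡ᵇ n) ≡ false → m ≢ n
≡ᵇ-false⇒≢ m n eq m≡n = subst T eq (≡⇒≡ᵇ m n m≡n)

≢⇒≡ᵇ-false : ∀ m n → m ≢ n → (m ≡ᵇ n) ≡ false
≢⇒≡ᵇ-false m n m≢n with m ≡ᵇ n in eq
... | true  = ⊥-elim (m≢n (≡ᵇ-true⇒≡ m n eq))
... | false = refl

∨-false⁻ : ∀ a {b} → a ∨ b ≡ false → a ≡ false × b ≡ false
∨-false⁻ false eq = refl , eq

lowerVar : ℕ → ℕ → ℕ
lowerVar c j = if j <ᵇ c then j else pred j

shiftVar : ℕ → ℕ → ℕ
shiftVar c j = if j <ᵇ c then j else suc j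

lowerVar-suc : ∀ c x → x ≢ c → lowerVar (suc c) (suc x) ≡ suc (lowerVar c x)
lowerVar-suc c x x≢c with x <ᵇ c in lt
... | true = refl
lowerVar-suc zero    zero    x≢c | false = ⊥-elim (x≢c refl)
lowerVar-suc (suc c) zero    x≢c | false with lt
... | ()
lowerVar-suc c       (suc x) x≢c | false = refl

≢-pred : ∀ {x c} → suc x ≢ suc c → x ≢ c
≢-pred sx≢sc x≡c = sx≢sc (cong suc x≡c)

lowerVar-injective : ∀ c x y → x ≢ c → y ≢ c → lowerVar c x ≡ lowerVar c y → x ≡ y
lowerVar-injective zero    zero    _       x≢c _   _  = ⊥-elim (x≢c refl)
lowerVar-injective zero    (suc x) zero    _   y≢c _  = ⊥-elim (y≢c refl)
lowerVar-injective zero    (suc x) (suc y) _   _   eq = cong suc eq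
lowerVar-injective (suc c) zero    zero    _   _   _  = refl
lowerVar-injective (suc c) zero    (suc y) _   y≢c eq with trans eq (lowerVar-suc c y (≢-pred y≢c))
... | ()
lowerVar-injective (suc c) (suc x) zero    x≢c _   eq with trans (sym eq) (lowerVar-suc c x (≢-pred x≢c))
... | ()
lowerVar-injective (suc c) (suc x) (suc y) x≢c y≢c eq =
  cong suc (lowerVar-injective c x y (≢-pred x≢c) (≢-pred y≢c)
    (suc-injective (trans (sym (lowerVar-suc c x (≢-pred x≢c)))
                          (trans eq (lowerVar-suc c y (≢-pred y≢c))))))

shiftVar-suc : ∀ c j → shiftVar (suc c) (suc j) ≡ suc (shiftVar c j)
shiftVar-suc c j with j <ᵇ c
... | true  = refl
... | false = refl

shiftVar-≢ : ∀ c j → shiftVar c j ≢ c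
shiftVar-≢ zero    j       ()
shiftVar-≢ (suc c) zero    ()
shiftVar-≢ (suc c) (suc j) eq = shiftVar-≢ c j (suc-injective (trans (sym (shiftVar-suc c j)) eq))

lowerVar-shiftVar : ∀ c j → lowerVar c (shiftVar c j) ≡ j
lowerVar-shiftVar zero    j       = refl
lowerVar-shiftVar (suc c) zero    = refl
lowerVar-shiftVar (suc c) (suc j) =
  trans (cong (lowerVar (suc c)) (shiftVar-suc c j))
    (trans (lowerVar-suc c (shiftVar c j) (shiftVar-≢ c j)) (cong suc (lowerVar-shiftVar c j)))

mutual
  freeT-shiftT : ∀ c N → freeT c (shiftT c N) ≡ false
  freeT-shiftT c (var j)   = ≢⇒≡ᵇ-false (shiftVar c j) c (shiftVar-≢ c j)
  freeT-shiftT c (lam M)   = freeT-shiftT (suc c) M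
  freeT-shiftT c (app M P) rewrite freeT-shiftT c M = freeL-shiftL c P
  freeT-shiftT c (tst V)   = freeL-shiftL c V

  freeL-shiftL : ∀ c P → freeL c (shiftL c P) ≡ false
  freeL-shiftL c []       = refl
  freeL-shiftL c (L ∷ Ls) rewrite freeT-shiftT c L = freeL-shiftL c Ls

mutual
  lowerT-shiftT : ∀ c N → lowerT c (shiftT c N) ≡ N
  lowerT-shiftT c (var j)   = cong var (lowerVar-shiftVar c j)
  lowerT-shiftT c (lam M)   = cong lam (lowerT-shiftT (suc c) M)
  lowerT-shiftT c (app M P) = cong₂ app (lowerT-shiftT c M) (lowerL-shiftL c P)
  lowerT-shiftT c (tst V)   = cong tst (lowerL-shiftL c V)

  lowerL-shiftL : ∀ c P → lowerL c (shiftL c P) ≡ P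
  lowerL-shiftL c []       = refl
  lowerL-shiftL c (L ∷ Ls) = cong₂ _∷_ (lowerT-shiftT c L) (lowerL-shiftL c Ls)

data Drop (c : ℕ) : List ℕ → Env → List ℕ → Env → Set where
  []   : Drop c [] [] [] []
  drop : ∀ {xs e ys e′} → Drop c xs e ys e′ → Drop c (c ∷ xs) ([] ∷ e) ys e′
  keep : ∀ {x xs s e ys e′} → x ≢ c → Drop c xs e ys e′ →
         Drop c (x ∷ xs) (s ∷ e) (lowerVar c x ∷ ys) (s ∷ e′)

Drop-emptyEnv⁺ : ∀ {c xs e ys e′} → Drop c xs e ys e′ →
  e ≡ emptyEnv (length xs) → e′ ≡ emptyEnv (length ys)
Drop-emptyEnv⁺ []         _    = refl
Drop-emptyEnv⁺ (drop d)   eq   = Drop-emptyEnv⁺ d (proj₂ (∷-injective eq))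
Drop-emptyEnv⁺ (keep _ d) refl = cong ([] ∷_) (Drop-emptyEnv⁺ d refl)

Drop-emptyEnv⁻ : ∀ {c xs e ys e′} → Drop c xs e ys e′ →
  e′ ≡ emptyEnv (length ys) → e ≡ emptyEnv (length xs)
Drop-emptyEnv⁻ []         _    = refl
Drop-emptyEnv⁻ (drop d)   eq   = cong ([] ∷_) (Drop-emptyEnv⁻ d eq)
Drop-emptyEnv⁻ (keep _ d) refl = cong ([] ∷_) (Drop-emptyEnv⁻ d refl)

Drop-var⁺ : ∀ {c xs e ys e′ i α} → Drop c xs e ys e′ → i ≢ c →
  (k : Fin (length xs)) → lookup xs k ≡ i → e ≡ unitEnv (length xs) k α →
  Σ (Fin (length ys)) λ k′ → lookup ys k′ ≡ lowerVar c i × e′ ≡ unitEnv (length ys) k′ α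
Drop-var⁺ (drop d)   i≢c fzero    refl _    = ⊥-elim (i≢c refl)
Drop-var⁺ (drop d)   i≢c (fsuc k) eq   refl = Drop-var⁺ d i≢c k eq refl
Drop-var⁺ (keep _ d) i≢c fzero    refl refl = fzero , refl , cong (_ ∷_) (Drop-emptyEnv⁺ d refl)
Drop-var⁺ (keep _ d) i≢c (fsuc k) eq   refl with Drop-var⁺ d i≢c k eq refl
... | k′ , eq′ , refl = fsuc k′ , eq′ , refl

Drop-var⁻ : ∀ {c xs e ys e′ i α} → Drop c xs e ys e′ → i ≢ c →
  (k′ : Fin (length ys)) → lookup ys k′ ≡ lowerVar c i → e′ ≡ unitEnv (length ys) k′ α →
  Σ (Fin (length xs)) λ k → lookup xs k ≡ i × e ≡ unitEnv (length xs) k α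
Drop-var⁻ (drop d) i≢c k′ eq eq′ with Drop-var⁻ d i≢c k′ eq eq′
... | k , eq″ , refl = fsuc k , eq″ , refl
Drop-var⁻ {c} (keep {x} x≢c d) i≢c fzero eq refl =
  fzero , lowerVar-injective c x _ x≢c i≢c eq , cong (_ ∷_) (Drop-emptyEnv⁻ d refl)
Drop-var⁻ (keep _ d) i≢c (fsuc k′) eq refl with Drop-var⁻ d i≢c k′ eq refl
... | k , eq′ , refl = fsuc k , eq′ , refl

Drop-var-dropped : ∀ {c xs e ys e′ α} → Drop c xs e ys e′ →
  (k : Fin (length xs)) → lookup xs k ≡ c → e ≡ unitEnv (length xs) k α → ⊥
Drop-var-dropped (drop d)     fzero    _  ()
Drop-var-dropped (drop d)     (fsuc k) eq refl = Drop-var-dropped d k eq refl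
Drop-var-dropped (keep x≢c d) fzero    eq refl = x≢c eq
Drop-var-dropped (keep _ d)   (fsuc k) eq refl = Drop-var-dropped d k eq refl

Drop-⊎E⁺ : ∀ {c xs e ys e′} → Drop c xs e ys e′ → ∀ e₁ e₂ → e ≡ e₁ ⊎E e₂ →
  length e₁ ≡ length xs → length e₂ ≡ length xs →
  Σ Env λ e₁′ → Σ Env λ e₂′ → e′ ≡ e₁′ ⊎E e₂′ × Drop c xs e₁ ys e₁′ × Drop c xs e₂ ys e₂′
Drop-⊎E⁺ [] [] [] refl _ _ = [] , [] , refl , [] , []
Drop-⊎E⁺ (drop d) (s₁ ∷ e₁) (s₂ ∷ e₂) eq l₁ l₂
  with ++-conicalˡ s₁ s₂ (sym (proj₁ (∷-injective eq)))
     | ++-conicalʳ s₁ s₂ (sym (proj₁ (∷-injective eq)))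
... | refl | refl with Drop-⊎E⁺ d e₁ e₂ (proj₂ (∷-injective eq)) (suc-injective l₁) (suc-injective l₂)
... | e₁′ , e₂′ , eq′ , d₁ , d₂ = e₁′ , e₂′ , eq′ , drop d₁ , drop d₂
Drop-⊎E⁺ (keep x≢c d) (s₁ ∷ e₁) (s₂ ∷ e₂) refl l₁ l₂
  with Drop-⊎E⁺ d e₁ e₂ refl (suc-injective l₁) (suc-injective l₂)
... | e₁′ , e₂′ , refl , d₁ , d₂ = s₁ ∷ e₁′ , s₂ ∷ e₂′ , refl , keep x≢c d₁ , keep x≢c d₂

Drop-⊎E⁻ : ∀ {c xs e ys e′} → Drop c xs e ys e′ → ∀ e₁′ e₂′ → e′ ≡ e₁′ ⊎E e₂′ →
  length e₁′ ≡ length ys → length e₂′ ≡ length ys →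
  Σ Env λ e₁ → Σ Env λ e₂ → e ≡ e₁ ⊎E e₂ × Drop c xs e₁ ys e₁′ × Drop c xs e₂ ys e₂′
Drop-⊎E⁻ [] [] [] refl _ _ = [] , [] , refl , [] , []
Drop-⊎E⁻ (drop d) e₁′ e₂′ eq l₁ l₂ with Drop-⊎E⁻ d e₁′ e₂′ eq l₁ l₂
... | e₁ , e₂ , refl , d₁ , d₂ = [] ∷ e₁ , [] ∷ e₂ , refl , drop d₁ , drop d₂
Drop-⊎E⁻ (keep x≢c d) (s₁ ∷ e₁′) (s₂ ∷ e₂′) refl l₁ l₂
  with Drop-⊎E⁻ d e₁′ e₂′ refl (suc-injective l₁) (suc-injective l₂)
... | e₁ , e₂ , refl , d₁ , d₂ = s₁ ∷ e₁ , s₂ ∷ e₂ , refl , keep x≢c d₁ , keep x≢c d₂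

Drop-under-λ : ∀ {c xs e ys e′} b → Drop c xs e ys e′ →
  Drop (suc c) (map suc xs ++ [ 0 ]) (e ++ [ b ]) (map suc ys ++ [ 0 ]) (e′ ++ [ b ])
Drop-under-λ b []       = keep (λ ()) []
Drop-under-λ b (drop d) = drop (Drop-under-λ b d)
Drop-under-λ {c} b (keep {x} {xs} {s} {e} {ys} {e′} x≢c d) =
  subst (λ z → Drop (suc c) (map suc (x ∷ xs) ++ [ 0 ]) ((s ∷ e) ++ [ b ])
                       (z ∷ map suc ys ++ [ 0 ]) ((s ∷ e′) ++ [ b ]))
    (lowerVar-suc c x x≢c) (keep (λ p → x≢c (suc-injective p)) (Drop-under-λ b d))

Drop-bound : ∀ xs e → length e ≡ length xs → Drop 0 (map suc xs ++ [ 0 ]) (e ++ [ [] ]) xs e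
Drop-bound []       []      _ = drop []
Drop-bound (x ∷ xs) (s ∷ e) l = keep (λ ()) (Drop-bound xs e (suc-injective l))

mutual
  ⟦lowerT⟧⁺ : ∀ M {c xs e ys e′ α} → freeT c M ≡ false → Drop c xs e ys e′ →
    ⟦ M ⟧T xs e α → ⟦ lowerT c M ⟧T ys e′ α
  ⟦lowerT⟧⁺ (var i) {c} fresh d (k , eq , e≡) = Drop-var⁺ d (≡ᵇ-false⇒≢ i c fresh) k eq e≡
  ⟦lowerT⟧⁺ (lam M) fresh d (b , as , refl , h) = b , as , refl , ⟦lowerT⟧⁺ M fresh (Drop-under-λ b d) h
  ⟦lowerT⟧⁺ (app M P) {c} fresh d (e₁ , e₂ , b , γ , refl , h₁ , γ≈ , h₂)
    with ∨-false⁻ (freeT c M) fresh | Drop-⊎E⁺ d e₁ e₂ refl (⟦⟧T-length M h₁) (⟦⟧B-length P h₂)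
  ... | fresh₁ , fresh₂ | e₁′ , e₂′ , refl , d₁ , d₂ =
    e₁′ , e₂′ , b , γ , refl , ⟦lowerT⟧⁺ M fresh₁ d₁ h₁ , γ≈ , ⟦lowerL⟧⁺ P fresh₂ d₂ h₂
  ⟦lowerT⟧⁺ (tst V) fresh d (h , refl) with ⟦⟧V⇒⟦⟧B V h
  ... | b , hb , ⋆s = ⟦⟧B⇒⟦⟧V (lowerL _ V) (⟦lowerL⟧⁺ V fresh d hb) ⋆s , refl

  ⟦lowerL⟧⁺ : ∀ P {c xs e ys e′ b} → freeL c P ≡ false → Drop c xs e ys e′ →
    ⟦ P ⟧B xs e b → ⟦ lowerL c P ⟧B ys e′ b
  ⟦lowerL⟧⁺ []       fresh d (e≡ , refl) = Drop-emptyEnv⁺ d e≡ , refl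
  ⟦lowerL⟧⁺ (L ∷ Ls) {c} fresh d (e₁ , e₂ , b , bs , refl , refl , h₁ , h₂)
    with ∨-false⁻ (freeT c L) fresh | Drop-⊎E⁺ d e₁ e₂ refl (⟦⟧T-length L h₁) (⟦⟧B-length Ls h₂)
  ... | fresh₁ , fresh₂ | e₁′ , e₂′ , refl , d₁ , d₂ =
    e₁′ , e₂′ , b , bs , refl , refl , ⟦lowerT⟧⁺ L fresh₁ d₁ h₁ , ⟦lowerL⟧⁺ Ls fresh₂ d₂ h₂

mutual
  ⟦lowerT⟧⁻ : ∀ M {c xs e ys e′ α} → freeT c M ≡ false → Drop c xs e ys e′ →
    ⟦ lowerT c M ⟧T ys e′ α → ⟦ M ⟧T xs e α
  ⟦lowerT⟧⁻ (var i) {c} fresh d (k , eq , e≡) = Drop-var⁻ d (≡ᵇ-false⇒≢ i c fresh) k eq e≡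
  ⟦lowerT⟧⁻ (lam M) fresh d (b , as , refl , h) = b , as , refl , ⟦lowerT⟧⁻ M fresh (Drop-under-λ b d) h
  ⟦lowerT⟧⁻ (app M P) {c} fresh d (e₁′ , e₂′ , b , γ , refl , h₁ , γ≈ , h₂)
    with ∨-false⁻ (freeT c M) fresh
       | Drop-⊎E⁻ d e₁′ e₂′ refl (⟦⟧T-length (lowerT c M) h₁) (⟦⟧B-length (lowerL c P) h₂)
  ... | fresh₁ , fresh₂ | e₁ , e₂ , refl , d₁ , d₂ =
    e₁ , e₂ , b , γ , refl , ⟦lowerT⟧⁻ M fresh₁ d₁ h₁ , γ≈ , ⟦lowerL⟧⁻ P fresh₂ d₂ h₂
  ⟦lowerT⟧⁻ (tst V) {c} fresh d (h , refl) with ⟦⟧V⇒⟦⟧B (lowerL c V) h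
  ... | b , hb , ⋆s = ⟦⟧B⇒⟦⟧V V (⟦lowerL⟧⁻ V fresh d hb) ⋆s , refl

  ⟦lowerL⟧⁻ : ∀ P {c xs e ys e′ b} → freeL c P ≡ false → Drop c xs e ys e′ →
    ⟦ lowerL c P ⟧B ys e′ b → ⟦ P ⟧B xs e b
  ⟦lowerL⟧⁻ []       fresh d (e≡ , refl) = Drop-emptyEnv⁻ d e≡ , refl
  ⟦lowerL⟧⁻ (L ∷ Ls) {c} fresh d (e₁′ , e₂′ , b , bs , refl , refl , h₁ , h₂)
    with ∨-false⁻ (freeT c L) fresh
       | Drop-⊎E⁻ d e₁′ e₂′ refl (⟦⟧T-length (lowerT c L) h₁) (⟦⟧B-length (lowerL c Ls) h₂)
  ... | fresh₁ , fresh₂ | e₁ , e₂ , refl , d₁ , d₂ =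
    e₁ , e₂ , b , bs , refl , refl , ⟦lowerT⟧⁻ L fresh₁ d₁ h₁ , ⟦lowerL⟧⁻ Ls fresh₂ d₂ h₂

mutual
  Drop⇒freshT : ∀ M {c xs e ys e′ α} → Drop c xs e ys e′ → ⟦ M ⟧T xs e α → freeT c M ≡ false
  Drop⇒freshT (var i) {c} d (k , eq , e≡) =
    ≢⇒≡ᵇ-false i c (λ i≡c → Drop-var-dropped d k (trans eq i≡c) e≡)
  Drop⇒freshT (lam M) d (b , _ , refl , h) = Drop⇒freshT M (Drop-under-λ b d) h
  Drop⇒freshT (app M P) d (e₁ , e₂ , _ , _ , refl , h₁ , _ , h₂)
    with Drop-⊎E⁺ d e₁ e₂ refl (⟦⟧T-length M h₁) (⟦⟧B-length P h₂)
  ... | _ , _ , _ , d₁ , d₂ rewrite Drop⇒freshT M d₁ h₁ = Drop⇒freshL P d₂ h₂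
  Drop⇒freshT (tst V) d (h , _) = Drop⇒freshL V d (proj₁ (proj₂ (⟦⟧V⇒⟦⟧B V h)))

  Drop⇒freshL : ∀ P {c xs e ys e′ b} → Drop c xs e ys e′ → ⟦ P ⟧B xs e b → freeL c P ≡ false
  Drop⇒freshL []       d _ = refl
  Drop⇒freshL (L ∷ Ls) d (e₁ , e₂ , _ , _ , refl , _ , h₁ , h₂)
    with Drop-⊎E⁺ d e₁ e₂ refl (⟦⟧T-length L h₁) (⟦⟧B-length Ls h₂)
  ... | _ , _ , _ , d₁ , d₂ rewrite Drop⇒freshT L d₁ h₁ = Drop⇒freshL Ls d₂ h₂

EmptyAt : ℕ → List ℕ → Env → Set
EmptyAt c = Pointwise (λ x s → x ≡ c → s ≡ [])

EmptyAt-emptyEnv : ∀ c xs → EmptyAt c xs (emptyEnv (length xs))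
EmptyAt-emptyEnv c []       = []
EmptyAt-emptyEnv c (x ∷ xs) = (λ _ → refl) ∷ EmptyAt-emptyEnv c xs

EmptyAt-unitEnv : ∀ c xs (k : Fin (length xs)) α → lookup xs k ≢ c →
  EmptyAt c xs (unitEnv (length xs) k α)
EmptyAt-unitEnv c (x ∷ xs) fzero    α x≢c = (λ x≡c → ⊥-elim (x≢c x≡c)) ∷ EmptyAt-emptyEnv c xs
EmptyAt-unitEnv c (x ∷ xs) (fsuc k) α k≢c = (λ _ → refl) ∷ EmptyAt-unitEnv c xs k α k≢c

EmptyAt-⊎E : ∀ {c xs e₁ e₂} → EmptyAt c xs e₁ → EmptyAt c xs e₂ → EmptyAt c xs (e₁ ⊎E e₂)
EmptyAt-⊎E []       []       = []
EmptyAt-⊎E (p ∷ ps) (q ∷ qs) =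
  (λ x≡c → subst (λ z → z ++ _ ≡ []) (sym (p x≡c)) (q x≡c)) ∷ EmptyAt-⊎E ps qs

EmptyAt-under-λ⁻ : ∀ {c} xs e b → EmptyAt (suc c) (map suc xs ++ [ 0 ]) (e ++ [ b ]) →
  length e ≡ length xs → EmptyAt c xs e
EmptyAt-under-λ⁻ []       []      b _        _ = []
EmptyAt-under-λ⁻ (x ∷ xs) (s ∷ e) b (p ∷ ps) l =
  (λ x≡c → p (cong suc x≡c)) ∷ EmptyAt-under-λ⁻ xs e b ps (suc-injective l)

mutual
  ⟦⟧T-EmptyAt : ∀ M {c xs e α} → freeT c M ≡ false → ⟦ M ⟧T xs e α → EmptyAt c xs e
  ⟦⟧T-EmptyAt (var i) {c} {xs} fresh (k , eq , refl) =
    EmptyAt-unitEnv c xs k _ (λ k≡c → ≡ᵇ-false⇒≢ i c fresh (trans (sym eq) k≡c))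
  ⟦⟧T-EmptyAt (lam M) {xs = xs} {e} fresh (b , _ , refl , h) =
    EmptyAt-under-λ⁻ xs e b (⟦⟧T-EmptyAt M fresh h) (⟦⟧T-length (lam M) (b , _ , refl , h))
  ⟦⟧T-EmptyAt (app M P) {c} fresh (_ , _ , _ , _ , refl , h₁ , _ , h₂) with ∨-false⁻ (freeT c M) fresh
  ... | fresh₁ , fresh₂ = EmptyAt-⊎E (⟦⟧T-EmptyAt M fresh₁ h₁) (⟦⟧B-EmptyAt P fresh₂ h₂)
  ⟦⟧T-EmptyAt (tst V) fresh (h , _) = ⟦⟧B-EmptyAt V fresh (proj₁ (proj₂ (⟦⟧V⇒⟦⟧B V h)))

  ⟦⟧B-EmptyAt : ∀ P {c xs e b} → freeL c P ≡ false → ⟦ P ⟧B xs e b → EmptyAt c xs e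
  ⟦⟧B-EmptyAt []       {c} {xs} _ (refl , _) = EmptyAt-emptyEnv c xs
  ⟦⟧B-EmptyAt (L ∷ Ls) {c} fresh (_ , _ , _ , _ , refl , _ , h₁ , h₂) with ∨-false⁻ (freeT c L) fresh
  ... | fresh₁ , fresh₂ = EmptyAt-⊎E (⟦⟧T-EmptyAt L fresh₁ h₁) (⟦⟧B-EmptyAt Ls fresh₂ h₂)

EmptyAt-bound : ∀ xs E → EmptyAt 0 (map suc xs ++ [ 0 ]) E →
  Σ Env λ e → E ≡ e ++ [ [] ] × Drop 0 (map suc xs ++ [ 0 ]) E xs e
EmptyAt-bound []       (s ∷ []) (p ∷ []) with p refl
... | refl = [] , refl , drop []
EmptyAt-bound (x ∷ xs) (s ∷ E)  (p ∷ ps) with EmptyAt-bound xs E ps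
... | e , refl , d = s ∷ e , refl , keep (λ ()) d

⟦shiftT⟧⁺ : ∀ N {xs e α} → ⟦ N ⟧T xs e α → ⟦ shiftT 0 N ⟧T (map suc xs ++ [ 0 ]) (e ++ [ [] ]) α
⟦shiftT⟧⁺ N {xs} {e} h =
  ⟦lowerT⟧⁻ (shiftT 0 N) (freeT-shiftT 0 N) (Drop-bound xs e (⟦⟧T-length N h))
    (subst (λ z → ⟦ z ⟧T _ _ _) (sym (lowerT-shiftT 0 N)) h)

⟦shiftT⟧⁻ : ∀ N {xs E α} → ⟦ shiftT 0 N ⟧T (map suc xs ++ [ 0 ]) E α →
  Σ Env λ e → E ≡ e ++ [ [] ] × ⟦ N ⟧T xs e α
⟦shiftT⟧⁻ N {xs} {E} h with EmptyAt-bound xs E (⟦⟧T-EmptyAt (shiftT 0 N) (freeT-shiftT 0 N) h)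
... | e , refl , d =
  e , refl ,
  subst (λ z → ⟦ z ⟧T _ _ _) (lowerT-shiftT 0 N) (⟦lowerT⟧⁺ (shiftT 0 N) (freeT-shiftT 0 N) d h)

erase-fresh : ∀ M → freeT 0 M ≡ false → erase 0 M ≡ [ lowerT 0 M ]
erase-fresh M fresh rewrite fresh = refl

∈-erase⁻ : ∀ M {N} → N ∈ erase 0 M → freeT 0 M ≡ false × N ≡ lowerT 0 M
∈-erase⁻ M m with freeT 0 M
∈-erase⁻ M (here refl) | false = refl , refl

⟦erase⟧⁺ : ∀ M {xs e α} → length e ≡ length xs →
  ⟦ M ⟧T (map suc xs ++ [ 0 ]) (e ++ [ [] ]) α → lowerT 0 M ∈ erase 0 M × ⟦ lowerT 0 M ⟧T xs e α
⟦erase⟧⁺ M {xs} {e} l h with Drop-bound xs e l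
... | d with Drop⇒freshT M d h
... | fresh = subst (lowerT 0 M ∈_) (sym (erase-fresh M fresh)) (here refl) , ⟦lowerT⟧⁺ M fresh d h

⟦erase⟧⁻ : ∀ M {N xs e α} → N ∈ erase 0 M → ⟦ N ⟧T xs e α → ⟦ M ⟧T (map suc xs ++ [ 0 ]) (e ++ [ [] ]) α
⟦erase⟧⁻ M {xs = xs} {e} m h with ∈-erase⁻ M m
... | fresh , refl = ⟦lowerT⟧⁻ M fresh (Drop-bound xs e (⟦⟧T-length (lowerT 0 M) h)) h

Near-length : ∀ N {xs e α} → Near {term} (⟦ N ⟧T xs) e α → length e ≡ length xs
Near-length N (_ , _ , e≈ , _ , h) = trans (Pointwise-length e≈) (⟦⟧T-length N h)

Near-lam : ∀ M {xs e b as} → Near {term} (⟦ M ⟧T (map suc xs ++ [ 0 ])) (e ++ [ b ]) (seq as) →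
  Near {term} (⟦ lam M ⟧T xs) e (seq (b ∷ as))
Near-lam M {e = e} {b} (e′ , seq as′ , e≈ , seq as≈ , h) with ≈E-∷ʳ⁻ e b (≈E-sym e≈)
... | E , x , refl , E≈ , x≈ =
  E , seq (x ∷ as′) , ≈E-sym E≈ , seq (cons (≈M-sym x≈) as≈) , (x , as′ , refl , h)

Near-appˡ : ∀ M P {xs e₁ e₂ γ b α} → Near {term} (⟦ M ⟧T xs) e₁ γ → γ ≈D (b ∷D α) → ⟦ P ⟧B xs e₂ b →
  Near {term} (⟦ app M P ⟧T xs) (e₁ ⊎E e₂) α
Near-appˡ M P {e₂ = e₂} {α = α} (e₁′ , γ′ , e₁≈ , γ≈γ′ , h₁) γ≈ h₂ =
  e₁′ ⊎E e₂ , α , ⊎E-cong e₁≈ ≈E-refl , ≈D-refl α ,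
  (e₁′ , e₂ , _ , γ′ , refl , h₁ , ≈D-trans (≈D-sym γ≈γ′) γ≈ , h₂)

Near-appʳ : ∀ M P {xs e₁ e₂ γ b α} → ⟦ M ⟧T xs e₁ γ → γ ≈D (b ∷D α) → Near {bag} (⟦ P ⟧B xs) e₂ b →
  Near {term} (⟦ app M P ⟧T xs) (e₁ ⊎E e₂) α
Near-appʳ M P {e₁ = e₁} {γ = γ} {α = α} h₁ γ≈ (e₂′ , b′ , e₂≈ , b≈ , h₂) =
  e₁ ⊎E e₂′ , α , ⊎E-cong ≈E-refl e₂≈ , ≈D-refl α ,
  (e₁ , e₂′ , b′ , γ , refl , h₁ , ≈D-trans γ≈ (∷D-cong α b≈) , h₂)

Near-tst : ∀ V {xs e b} → Near {bag} (⟦ V ⟧B xs) e b → IsStar b → Near {term} (⟦ tst V ⟧T xs) e star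
Near-tst V (e′ , b′ , e≈ , b≈ , h) ⋆s =
  e′ , star , e≈ , ≈D-refl star , ⟦⟧B⇒⟦⟧V V h (IsStar-resp-≈M (≈M-sym b≈) ⋆s) , refl

Near-∷ˡ : ∀ L Ls {xs e₁ e₂ b bs} → Near {term} (⟦ L ⟧T xs) e₁ b → ⟦ Ls ⟧B xs e₂ bs →
  Near {bag} (⟦ L ∷ Ls ⟧B xs) (e₁ ⊎E e₂) (b ∷ bs)
Near-∷ˡ L Ls {e₂ = e₂} {bs = bs} (e₁′ , b′ , e₁≈ , b≈ , h₁) h₂ =
  e₁′ ⊎E e₂ , b′ ∷ bs , ⊎E-cong e₁≈ ≈E-refl , ≈M-cons b≈ (≈M-refl bs) ,
  (e₁′ , e₂ , b′ , bs , refl , refl , h₁ , h₂)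

Near-∷ʳ : ∀ L Ls {xs e₁ e₂ b bs} → ⟦ L ⟧T xs e₁ b → Near {bag} (⟦ Ls ⟧B xs) e₂ bs →
  Near {bag} (⟦ L ∷ Ls ⟧B xs) (e₁ ⊎E e₂) (b ∷ bs)
Near-∷ʳ L Ls {e₁ = e₁} {b = b} h₁ (e₂′ , bs′ , e₂≈ , bs≈ , h₂) =
  e₁ ⊎E e₂′ , b ∷ bs′ , ⊎E-cong ≈E-refl e₂≈ , ≈M-cons (≈D-refl b) bs≈ ,
  (e₁ , e₂′ , b , bs′ , refl , refl , h₁ , h₂)

Near-shiftT : ∀ N {xs e α} → Near {term} (⟦ N ⟧T xs) e α →
  Near {term} (⟦ shiftT 0 N ⟧T (map suc xs ++ [ 0 ])) (e ++ [ [] ]) α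
Near-shiftT N (e′ , α′ , e≈ , α≈ , h) =
  e′ ++ [ [] ] , α′ , Pointwise.++⁺ e≈ ([] ∷ []) , α≈ , ⟦shiftT⟧⁺ N h

-- The substitution lemma

-- The interpretation of a linear substitution A⟨N/x⟩, x the n-th variable: a point
-- of A whose n-th multiset contains some δ, glued with a point of N of value δ.
Subst : ∀ {s} → (Env → Pt s → Set) → (Env → D → Set) → ℕ → Env → Pt s → Set
Subst X Y n e′ p = Σ Env λ e → Σ D λ δ → Σ Env λ r → Σ Env λ eN →
  Pick n e δ r × X e p × Y eN δ × e′ ≡ r ⊎E eN

-- N's point is only needed up to ≈: in a β-redex the bag element fed to x is merely
-- ≈ to the value picked from x's multiset.
mutual
  ⟦lsubT⟧⁺ : ∀ M N {xs n k} → xs [ n ]= k →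
    Subst {term} (⟦ M ⟧T xs) (Near {term} (⟦ N ⟧T xs)) n ⊑T ⟦ lsubT k N M ⟧TΣ xs
  ⟦lsubT⟧⁺ (var i) N x _ _ (_ , δ , r , eN , p , (q , eq , refl) , hN , refl)
    with Pick-unitEnv⁻ q x p
  ... | lk , refl , refl with trans (sym eq) lk
  ... | refl rewrite ≡ᵇ-refl i =
    Near-lose {term} (here refl) (Near-resp-≈E (≈E-reflexive (⊎E-emptyEnvˡ eN (Near-length N hN))) hN)
  ⟦lsubT⟧⁺ (lam M) N x _ _ (e , δ , r , eN , p , (b , as , refl , hM) , hN , refl) =
    let M′ , m , near = Near-find {term} (⟦lsubT⟧⁺ M (shiftT 0 N) ([]=-under-λ x) _ _
                          (e ++ [ b ] , δ , r ++ [ b ] , eN ++ [ [] ] , Pick-∷ʳ p , hM ,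
                           Near-shiftT N hN , refl))
    in Near-lose {term} (∈-map⁺ lam m)
         (Near-lam M′ (subst (λ z → Near {term} (⟦ M′ ⟧T _) z (seq as)) (⊎E-∷ʳ-[] r eN len) near))
    where
    len : length r ≡ length eN
    len = trans (Pick-length p)
                (trans (⟦⟧T-length (lam M) (b , as , refl , hM)) (sym (Near-length N hN)))
  ⟦lsubT⟧⁺ (app M P) N x _ _ (_ , δ , r , eN , p , (e₁ , e₂ , b , γ , refl , h₁ , γ≈ , h₂) , hN , refl)
    with Pick-⊎E⁻ e₁ e₂ p
  ... | inj₁ (r₁ , p₁ , refl) =
    let M′ , m , near = Near-find {term} (⟦lsubT⟧⁺ M N x _ _ (e₁ , δ , r₁ , eN , p₁ , h₁ , hN , refl))
    in Near-lose {term} (∈-++⁺ˡ (∈-map⁺ (λ z → app z P) m))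
         (Near-resp-≈E (⊎E-swapʳ r₁ e₂ eN) (Near-appˡ M′ P near γ≈ h₂))
  ... | inj₂ (r₂ , p₂ , refl) =
    let P′ , m , near = Near-find {bag} (⟦lsubL⟧⁺ P N x _ _ (e₂ , δ , r₂ , eN , p₂ , h₂ , hN , refl))
    in Near-lose {term} (∈-++⁺ʳ _ (∈-map⁺ (app M) m))
         (Near-resp-≈E (≈E-reflexive (⊎E-assoc e₁ r₂ eN)) (Near-appʳ M P′ h₁ γ≈ near))
  ⟦lsubT⟧⁺ (tst V) N x _ _ (e , δ , r , eN , p , (hV , refl) , hN , refl) =
    let b , hb , ⋆s = ⟦⟧V⇒⟦⟧B V hV
        V′ , m , near = Near-find {bag} (⟦lsubL⟧⁺ V N x _ _ (e , δ , r , eN , p , hb , hN , refl))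
    in Near-lose {term} (∈-map⁺ tst m) (Near-tst V′ near ⋆s)

  ⟦lsubL⟧⁺ : ∀ P N {xs n k} → xs [ n ]= k →
    Subst {bag} (⟦ P ⟧B xs) (Near {term} (⟦ N ⟧T xs)) n ⊑B ⟦ lsubL k N P ⟧BΣ xs
  ⟦lsubL⟧⁺ []       N x _ _ (_ , _ , _ , _ , p , (refl , _) , _ , _) = ⊥-elim (Pick-emptyEnv p)
  ⟦lsubL⟧⁺ (L ∷ Ls) N x _ _ (_ , δ , r , eN , p , (e₁ , e₂ , b , bs , refl , refl , h₁ , h₂) , hN , refl)
    with Pick-⊎E⁻ e₁ e₂ p
  ... | inj₁ (r₁ , p₁ , refl) =
    let L′ , m , near = Near-find {term} (⟦lsubT⟧⁺ L N x _ _ (e₁ , δ , r₁ , eN , p₁ , h₁ , hN , refl))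
    in Near-lose {bag} (∈-++⁺ˡ (∈-map⁺ (_∷ Ls) m))
         (Near-resp-≈E (⊎E-swapʳ r₁ e₂ eN) (Near-∷ˡ L′ Ls near h₂))
  ... | inj₂ (r₂ , p₂ , refl) =
    let Ls′ , m , near = Near-find {bag} (⟦lsubL⟧⁺ Ls N x _ _ (e₂ , δ , r₂ , eN , p₂ , h₂ , hN , refl))
    in Near-lose {bag} (∈-++⁺ʳ _ (∈-map⁺ (L ∷_) m))
         (Near-resp-≈E (≈E-reflexive (⊎E-assoc e₁ r₂ eN)) (Near-∷ʳ L Ls′ h₁ near))

Subst-lam : ∀ M N {xs n k e′ b as} → xs [ n ]= k →
  Near {term} (Subst {term} (⟦ M ⟧T (map suc xs ++ [ 0 ])) (⟦ shiftT 0 N ⟧T (map suc xs ++ [ 0 ])) n)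
    (e′ ++ [ b ]) (seq as) →
  Near {term} (Subst {term} (⟦ lam M ⟧T xs) (⟦ N ⟧T xs) n) e′ (seq (b ∷ as))
Subst-lam M N {xs} {e′ = e′} x (_ , seq as′ , e≈ , seq as≈ , E , δ , R , EN , p , hM , hN , refl)
  with ⟦shiftT⟧⁻ N hN | ∷ʳ-split (map suc xs) E (⟦⟧T-length M hM)
... | eN , refl , hN′ | E₀ , c , refl , lE₀
  with Pick-∷ʳ⁻ E₀ p (subst (_ <_) (sym (trans lE₀ (length-map suc xs))) ([]=-<length x))
... | R₀ , refl , p₀
  with ≈E-∷ʳ-injective e′ (R₀ ⊎E eN) (subst (e′ ++ [ _ ] ≈E_) (⊎E-∷ʳ-[] R₀ eN
         (trans (Pick-length p₀) (trans lE₀ (trans (length-map suc xs) (sym (⟦⟧T-length N hN′)))))) e≈)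
... | e′≈ , b≈c =
  R₀ ⊎E eN , seq (c ∷ as′) , e′≈ , seq (cons b≈c as≈) ,
  (E₀ , δ , R₀ , eN , p₀ , (c , as′ , refl , hM) , hN′ , refl)

Subst-appˡ : ∀ M P {Y xs n e₁ e₂ γ b α} → Near {term} (Subst {term} (⟦ M ⟧T xs) Y n) e₁ γ →
  γ ≈D (b ∷D α) → ⟦ P ⟧B xs e₂ b → Near {term} (Subst {term} (⟦ app M P ⟧T xs) Y n) (e₁ ⊎E e₂) α
Subst-appˡ M P {e₂ = e₂} {α = α} (_ , γ′ , e₁≈ , γ≈γ′ , e , δ , r , eN , p , hM , hN , refl) γ≈ h₂ =
  (r ⊎E e₂) ⊎E eN , α , ≈E-trans (⊎E-cong e₁≈ ≈E-refl) (⊎E-swapʳ r eN e₂) , ≈D-refl α ,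
  (e ⊎E e₂ , δ , r ⊎E e₂ , eN , Pick-⊎Eˡ e₂ p (trans (⟦⟧T-length M hM) (sym (⟦⟧B-length P h₂))) ,
   (e , e₂ , _ , γ′ , refl , hM , ≈D-trans (≈D-sym γ≈γ′) γ≈ , h₂) , hN , refl)

Subst-appʳ : ∀ M P {Y xs n e₁ e₂ γ b α} → ⟦ M ⟧T xs e₁ γ → γ ≈D (b ∷D α) →
  Near {bag} (Subst {bag} (⟦ P ⟧B xs) Y n) e₂ b →
  Near {term} (Subst {term} (⟦ app M P ⟧T xs) Y n) (e₁ ⊎E e₂) α
Subst-appʳ M P {e₁ = e₁} {γ = γ} {α = α} h₁ γ≈
  (_ , b′ , e₂≈ , b≈ , e , δ , r , eN , p , hP , hN , refl) =
  (e₁ ⊎E r) ⊎E eN , α , ≈E-trans (⊎E-cong ≈E-refl e₂≈) (≈E-reflexive (sym (⊎E-assoc e₁ r eN))) ,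
  ≈D-refl α ,
  (e₁ ⊎E e , δ , e₁ ⊎E r , eN , Pick-⊎Eʳ e₁ p (trans (⟦⟧T-length M h₁) (sym (⟦⟧B-length P hP))) ,
   (e₁ , e , b′ , γ , refl , h₁ , ≈D-trans γ≈ (∷D-cong α b≈) , hP) , hN , refl)

Subst-tst : ∀ V {Y xs n e b} → Near {bag} (Subst {bag} (⟦ V ⟧B xs) Y n) e b → IsStar b →
  Near {term} (Subst {term} (⟦ tst V ⟧T xs) Y n) e star
Subst-tst V (e′ , b′ , e≈ , b≈ , e , δ , r , eN , p , hV , hN , refl) ⋆s =
  e′ , star , e≈ , ≈D-refl star ,
  (e , δ , r , eN , p , (⟦⟧B⇒⟦⟧V V hV (IsStar-resp-≈M (≈M-sym b≈) ⋆s) , refl) , hN , refl)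

Subst-∷ˡ : ∀ L Ls {Y xs n e₁ e₂ b bs} →
  Near {term} (Subst {term} (⟦ L ⟧T xs) Y n) e₁ b → ⟦ Ls ⟧B xs e₂ bs →
  Near {bag} (Subst {bag} (⟦ L ∷ Ls ⟧B xs) Y n) (e₁ ⊎E e₂) (b ∷ bs)
Subst-∷ˡ L Ls {e₂ = e₂} {bs = bs} (_ , b′ , e₁≈ , b≈ , e , δ , r , eN , p , hL , hN , refl) h₂ =
  (r ⊎E e₂) ⊎E eN , b′ ∷ bs , ≈E-trans (⊎E-cong e₁≈ ≈E-refl) (⊎E-swapʳ r eN e₂) ,
  ≈M-cons b≈ (≈M-refl bs) ,
  (e ⊎E e₂ , δ , r ⊎E e₂ , eN , Pick-⊎Eˡ e₂ p (trans (⟦⟧T-length L hL) (sym (⟦⟧B-length Ls h₂))) ,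
   (e , e₂ , b′ , bs , refl , refl , hL , h₂) , hN , refl)

Subst-∷ʳ : ∀ L Ls {Y xs n e₁ e₂ b bs} →
  ⟦ L ⟧T xs e₁ b → Near {bag} (Subst {bag} (⟦ Ls ⟧B xs) Y n) e₂ bs →
  Near {bag} (Subst {bag} (⟦ L ∷ Ls ⟧B xs) Y n) (e₁ ⊎E e₂) (b ∷ bs)
Subst-∷ʳ L Ls {e₁ = e₁} {b = b} h₁ (_ , bs′ , e₂≈ , bs≈ , e , δ , r , eN , p , hLs , hN , refl) =
  (e₁ ⊎E r) ⊎E eN , b ∷ bs′ , ≈E-trans (⊎E-cong ≈E-refl e₂≈) (≈E-reflexive (sym (⊎E-assoc e₁ r eN))) ,
  ≈M-cons (≈D-refl b) bs≈ ,
  (e₁ ⊎E e , δ , e₁ ⊎E r , eN , Pick-⊎Eʳ e₁ p (trans (⟦⟧T-length L h₁) (sym (⟦⟧B-length Ls hLs))) ,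
   (e₁ , e , b , bs′ , refl , refl , h₁ , hLs) , hN , refl)

mutual
  ⟦lsubT⟧⁻ : ∀ M N {xs n k M′} → xs [ n ]= k → M′ ∈ lsubT k N M →
    ⟦ M′ ⟧T xs ⊑T Subst {term} (⟦ M ⟧T xs) (⟦ N ⟧T xs) n
  ⟦lsubT⟧⁻ (var i) N {k = k} x m e′ α′ h with i ≡ᵇ k in i≡ᵇk
  ⟦lsubT⟧⁻ (var i) N {xs} {k = k} x (here refl) e′ α′ h | true =
    let q , lk , p = Pick-unitEnv α′ x
    in near {term} (unitEnv (length xs) q α′ , α′ , emptyEnv (length xs) , e′ , p ,
                    (q , trans lk (sym (≡ᵇ-true⇒≡ i k i≡ᵇk)) , refl) , h ,
                    sym (⊎E-emptyEnvˡ e′ (⟦⟧T-length N h)))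
  ⟦lsubT⟧⁻ (lam M) N x m _ _ h with ∈-map⁻ lam m | h
  ... | M′ , m′ , refl | b , as , refl , h′ =
    Subst-lam M N x (⟦lsubT⟧⁻ M (shiftT 0 N) ([]=-under-λ x) m′ _ _ h′)
  ⟦lsubT⟧⁻ (app M P) N x m _ _ h with ∈-++⁻ (map (λ z → app z P) (lsubT _ N M)) m
  ⟦lsubT⟧⁻ (app M P) N x m _ _ h | inj₁ m₁ with ∈-map⁻ (λ z → app z P) m₁ | h
  ... | M′ , m′ , refl | e₁ , e₂ , b , γ , refl , h₁ , γ≈ , h₂ =
    Subst-appˡ M P (⟦lsubT⟧⁻ M N x m′ e₁ γ h₁) γ≈ h₂
  ⟦lsubT⟧⁻ (app M P) N x m _ _ h | inj₂ m₂ with ∈-map⁻ (app M) m₂ | h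
  ... | P′ , m′ , refl | e₁ , e₂ , b , γ , refl , h₁ , γ≈ , h₂ =
    Subst-appʳ M P h₁ γ≈ (⟦lsubL⟧⁻ P N x m′ e₂ b h₂)
  ⟦lsubT⟧⁻ (tst V) N x m _ _ h with ∈-map⁻ tst m | h
  ... | V′ , m′ , refl | hV′ , refl =
    let b , hb , ⋆s = ⟦⟧V⇒⟦⟧B V′ hV′
    in Subst-tst V (⟦lsubL⟧⁻ V N x m′ _ b hb) ⋆s

  ⟦lsubL⟧⁻ : ∀ P N {xs n k P′} → xs [ n ]= k → P′ ∈ lsubL k N P →
    ⟦ P′ ⟧B xs ⊑B Subst {bag} (⟦ P ⟧B xs) (⟦ N ⟧T xs) n
  ⟦lsubL⟧⁻ (L ∷ Ls) N x m _ _ h with ∈-++⁻ (map (_∷ Ls) (lsubT _ N L)) m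
  ⟦lsubL⟧⁻ (L ∷ Ls) N x m _ _ h | inj₁ m₁ with ∈-map⁻ (_∷ Ls) m₁ | h
  ... | L′ , m′ , refl | e₁ , e₂ , b , bs , refl , refl , h₁ , h₂ =
    Subst-∷ˡ L Ls (⟦lsubT⟧⁻ L N x m′ e₁ b h₁) h₂
  ⟦lsubL⟧⁻ (L ∷ Ls) N x m _ _ h | inj₂ m₂ with ∈-map⁻ (L ∷_) m₂ | h
  ... | Ls′ , m′ , refl | e₁ , e₂ , b , bs , refl , refl , h₁ , h₂ =
    Subst-∷ʳ L Ls h₁ (⟦lsubL⟧⁻ Ls N x m′ e₂ bs h₂)

-- Substituting a bag

Feed : Tm → List Tm → List ℕ → List D → Env → D → Set
Feed M P xs c e α = Σ Env λ E → Σ (List D) λ c′ → Σ Env λ eP → Σ (List D) λ b →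
  ⟦ M ⟧T (map suc xs ++ [ 0 ]) (E ++ [ c′ ]) α × ⟦ P ⟧B xs eP b × c′ ≈M (b ++ c) × e ≡ E ⊎E eP

⟦lsubT⟧-bound⁺ : ∀ M L {xs c E α} → Feed M [ L ] xs c E α →
  Near {term} (⟦ lsubT 0 (shiftT 0 L) M ⟧TΣ (map suc xs ++ [ 0 ])) (E ++ [ c ]) α
⟦lsubT⟧-bound⁺ M L {xs} {c} {α = α}
  (E , c′ , _ , _ , hM , (eL , _ , δ , _ , refl , refl , hL , (refl , refl)) , c′≈ , refl)
  with ≈M-sym c′≈
... | pick {bs1 = s₁} {s₂} refl δ≈ c≈ =
  Near-resp-≈ {term} (Pointwise.++⁺ (≈E-reflexive (cong (E ⊎E_) (⊎E-emptyEnvʳ eL lL))) (c≈ ∷ []))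
    (≈D-refl α)
    (subst (λ z → Near {term} (⟦ lsubT 0 (shiftT 0 L) M ⟧TΣ _) z α) (⊎E-∷ʳ-[] E eL (trans lE (sym lL)))
      (⟦lsubT⟧⁺ M (shiftT 0 L) ([]=-bound xs) _ _
        (E ++ [ s₁ ++ _ ∷ s₂ ] , _ , E ++ [ s₁ ++ s₂ ] , eL ++ [ [] ] , Pick-last E lE , hM ,
         Near-shiftT L (eL , δ , ≈E-refl , ≈D-sym δ≈ , hL) , refl)))
  where
  lE : length E ≡ length xs
  lE = ⟦⟧T-length-under-λ M hM
  lL : length eL ≡ length xs
  lL = ⟦⟧T-length L hL

Feed-∷⁻ : ∀ M L Ls {xs c e α} → Feed M (L ∷ Ls) xs c e α →
  Σ Env λ e₁ → Σ Env λ eLs → Σ (List D) λ bs →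
    Feed M [ L ] xs (bs ++ c) e₁ α × ⟦ Ls ⟧B xs eLs bs × e ≡ e₁ ⊎E eLs
Feed-∷⁻ M L Ls {xs} (E , c′ , _ , _ , hM , (eL , eLs , δ , bs , refl , refl , hL , hLs) , c′≈ , refl) =
  E ⊎E (eL ⊎E emptyEnv (length xs)) , eLs , bs ,
  (E , c′ , eL ⊎E emptyEnv (length xs) , [ δ ] , hM ,
   (eL , _ , δ , [] , refl , refl , hL , (refl , refl)) , c′≈ , refl) ,
  hLs ,
  sym (trans (⊎E-assoc E _ eLs) (cong (λ z → E ⊎E (z ⊎E eLs)) (⊎E-emptyEnvʳ eL (⟦⟧T-length L hL))))

⟦lsubBag⟧⁺ : ∀ P M {xs c e α} → Feed M P xs c e α →
  Near {term} (⟦ lsubBag 0 (shiftL 0 P) M ⟧TΣ (map suc xs ++ [ 0 ])) (e ++ [ c ]) α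
⟦lsubBag⟧⁺ [] M {xs} {c} {α = α} (E , c′ , _ , _ , hM , (refl , refl) , c′≈c , refl) =
  E ++ [ c′ ] , α ,
  Pointwise.++⁺ (≈E-reflexive (⊎E-emptyEnvʳ E (⟦⟧T-length-under-λ M hM))) (≈M-sym c′≈c ∷ []) ,
  ≈D-refl α , here hM
⟦lsubBag⟧⁺ (L ∷ Ls) M {c = c} feed with Feed-∷⁻ M L Ls feed
... | e₁ , eLs , bs , feed₁ , hLs , refl with Near-find {term} (⟦lsubT⟧-bound⁺ M L feed₁)
... | M₁ , m₁ , _ , α₁ , e≈ , α≈ , hM₁ with ≈E-∷ʳ⁻ e₁ (bs ++ c) (≈E-sym e≈)
... | E₁ , c₁ , refl , E₁≈ , c₁≈ =
  let M′ , m′ , near = Near-find {term} (⟦lsubBag⟧⁺ Ls M₁ (E₁ , c₁ , eLs , bs , hM₁ , hLs , c₁≈ , refl))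
  in Near-resp-≈ {term} (Pointwise.++⁺ (⊎E-cong (≈E-sym E₁≈) ≈E-refl) (≈M-refl c ∷ [])) α≈
       (Near-lose {term} (∈-concatMap⁺ (lsubBag 0 (shiftL 0 Ls)) (lose m₁ m′)) near)

⟦lsubT⟧-bound⁻ : ∀ M L {xs M₁ E₁ c₁ α} → M₁ ∈ lsubT 0 (shiftT 0 L) M →
  ⟦ M₁ ⟧T (map suc xs ++ [ 0 ]) (E₁ ++ [ c₁ ]) α → Near {term} (Feed M [ L ] xs c₁) E₁ α
⟦lsubT⟧-bound⁻ M L {xs} {E₁ = E₁} {c₁} m₁ h
  with ⟦lsubT⟧⁻ M (shiftT 0 L) ([]=-bound xs) m₁ _ _ h
... | _ , α′ , E₁c₁≈ , α≈ , (E , δ , R , EN , p , hM , hN , refl)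
  with ⟦shiftT⟧⁻ L hN | ∷ʳ-split (map suc xs) E (⟦⟧T-length M hM)
... | eL , refl , hL | E₀ , c , refl , lE₀
  with Pick-last⁻ E₀ (trans lE₀ (length-map suc xs)) p
... | s₁ , s₂ , refl , refl
  with ≈E-∷ʳ-injective E₁ (E₀ ⊎E eL) (subst (E₁ ++ [ c₁ ] ≈E_)
         (⊎E-∷ʳ-[] E₀ eL (trans lE₀ (trans (length-map suc xs) (sym (⟦⟧T-length L hL))))) E₁c₁≈)
... | E₁≈ , c₁≈ =
  E₀ ⊎E eL , α′ , E₁≈ , α≈ ,
  (E₀ , s₁ ++ δ ∷ s₂ , eL ⊎E emptyEnv (length xs) , [ δ ] , hM ,
   (eL , emptyEnv (length xs) , δ , [] , refl , refl , hL , (refl , refl)) ,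
   ≈M-insert s₁ (≈M-sym c₁≈) (≈D-refl δ) ,
   cong (E₀ ⊎E_) (sym (⊎E-emptyEnvʳ eL (⟦⟧T-length L hL))))

Feed-∷ : ∀ M L Ls {xs c c₁ E₁ eLs bs α} → Feed M [ L ] xs c₁ E₁ α → ⟦ Ls ⟧B xs eLs bs → c₁ ≈M (bs ++ c) →
  Feed M (L ∷ Ls) xs c (E₁ ⊎E eLs) α
Feed-∷ M L Ls {xs} {eLs = eLs} {bs}
  (E , c′ , _ , _ , hM , (eL , _ , δ , _ , refl , refl , hL , (refl , refl)) , c′≈ , refl) hLs c₁≈ =
  E , c′ , eL ⊎E eLs , δ ∷ bs , hM , (eL , eLs , δ , bs , refl , refl , hL , hLs) ,
  ≈M-trans c′≈ (≈M-cons (≈D-refl δ) c₁≈) ,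
  trans (⊎E-assoc E _ eLs) (cong (λ z → E ⊎E (z ⊎E eLs)) (⊎E-emptyEnvʳ eL (⟦⟧T-length L hL)))

⟦lsubBag⟧⁻ : ∀ P M {xs M′ c} → M′ ∈ lsubBag 0 (shiftL 0 P) M →
  (λ e α → ⟦ M′ ⟧T (map suc xs ++ [ 0 ]) (e ++ [ c ]) α) ⊑T Feed M P xs c
⟦lsubBag⟧⁻ [] M {xs} {c = c} (here refl) e α h =
  near {term} (e , c , emptyEnv (length xs) , [] , h , (refl , refl) , ≈M-refl c ,
               sym (⊎E-emptyEnvʳ e (⟦⟧T-length-under-λ M h)))
⟦lsubBag⟧⁻ (L ∷ Ls) M m e α h with find (∈-concatMap⁻ (lsubBag 0 (shiftL 0 Ls)) m)
... | M₁ , m₁ , m′ with ⟦lsubBag⟧⁻ Ls M₁ m′ e α h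
... | _ , α₁ , e≈ , α≈ , (E₁ , c₁ , eLs , bs , hM₁ , hLs , c₁≈ , refl) with ⟦lsubT⟧-bound⁻ M L m₁ hM₁
... | F , α₂ , E₁≈ , α≈′ , feed =
  F ⊎E eLs , α₂ , ≈E-trans e≈ (⊎E-cong E₁≈ ≈E-refl) , ≈D-trans α≈ α≈′ , Feed-∷ M L Ls feed hLs c₁≈

-- Redexes

Near-erase : ∀ S {xs e α} → Near {term} (⟦ S ⟧TΣ (map suc xs ++ [ 0 ])) (e ++ [ [] ]) α →
  Near {term} (⟦ concatMap (erase 0) S ⟧TΣ xs) e α
Near-erase S {e = e} near with Near-find {term} near
... | M , m , _ , α′ , e≈ , α≈ , h with ≈E-∷ʳ⁻ e [] (≈E-sym e≈)
... | E , x , refl , E≈ , x≈ with ≈M-[]ʳ x≈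
... | refl =
  let m′ , h′ = ⟦erase⟧⁺ M (⟦⟧T-length-under-λ M h) h
  in E , α′ , ≈E-sym E≈ , α≈ , lose (∈-concatMap⁺ (erase 0) (lose m m′)) h′

⟦β⟧⁺ : ∀ M P {xs} → ⟦ app (lam M) P ⟧T xs ⊑T ⟦ concatMap (erase 0) (lsubBag 0 (shiftL 0 P) M) ⟧TΣ xs
⟦β⟧⁺ M P e (seq asα) (e₁ , e₂ , b , _ , refl , (b′ , as , refl , hM) , seq (cons b′≈b as≈) , hP) =
  Near-resp-≈ {term} ≈E-refl (seq (≈Q-sym as≈))
    (Near-erase (lsubBag 0 (shiftL 0 P) M)
      (⟦lsubBag⟧⁺ P M (e₁ , b′ , e₂ , b , hM , hP , subst (b′ ≈M_) (sym (++-identityʳ b)) b′≈b , refl)))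

⟦β⟧⁻ : ∀ M P {xs} → ⟦ concatMap (erase 0) (lsubBag 0 (shiftL 0 P) M) ⟧TΣ xs ⊑T ⟦ app (lam M) P ⟧T xs
⟦β⟧⁻ M P e α h with find h
... | N , n , hN with find (∈-concatMap⁻ (erase 0) n)
... | M′ , m , m′ with ⟦lsubBag⟧⁻ P M m e α (⟦erase⟧⁻ M′ m′ hN)
... | _ , seq as , e≈ , α≈ , (E , c , eP , b , hM , hP , c≈ , refl) =
  E ⊎E eP , seq as , e≈ , α≈ ,
  (E , eP , b , seq (c ∷ as) , refl , (c , as , refl , hM) ,
   seq (cons (subst (c ≈M_) (++-identityʳ b) c≈) (≈Q-refl as)) , hP)

⟦τ[]⟧⁺ : ∀ V {xs} → ⟦ app (tst V) [] ⟧T xs ⊑T ⟦ [ tst V ] ⟧TΣ xs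
⟦τ[]⟧⁺ V {xs} e (seq as) (e₁ , _ , _ , _ , refl , (hV , refl) , seq (padL as≈) , (refl , refl)) =
  e₁ , star , ≈E-reflexive (⊎E-emptyEnvʳ e₁ (⟦⟧V-length V hV)) , seq (≈Q-sym as≈) , here (hV , refl)

⟦τ[]⟧⁻ : ∀ V {xs} → ⟦ [ tst V ] ⟧TΣ xs ⊑T ⟦ app (tst V) [] ⟧T xs
⟦τ[]⟧⁻ V {xs} e _ (here (hV , refl)) =
  e ⊎E emptyEnv (length xs) , star , ≈E-reflexive (sym (⊎E-emptyEnvʳ e (⟦⟧V-length V hV))) ,
  ≈D-refl star ,
  (e , emptyEnv (length xs) , [] , star , refl , (hV , refl) , seq (padL []) , (refl , refl))

-- ⋆ = seq [] is not ≈ to any sequence whose first multiset is nonempty.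
⟦τ∷⟧⁺ : ∀ V L Ls {xs} → ⟦ app (tst V) (L ∷ Ls) ⟧T xs ⊑T ⟦ [] ⟧TΣ xs
⟦τ∷⟧⁺ V L Ls e (seq _) (_ , _ , _ , _ , refl , (_ , refl) , seq () , (_ , _ , _ , _ , _ , refl , _))

⟦⟧V-++⁻ : ∀ A B {xs e} → ⟦ A ++ B ⟧V xs e →
  Σ Env λ eA → Σ Env λ eB → e ≡ eA ⊎E eB × ⟦ A ⟧V xs eA × ⟦ B ⟧V xs eB
⟦⟧V-++⁻ []      B {xs} {e} h =
  emptyEnv (length xs) , e , sym (⊎E-emptyEnvˡ e (⟦⟧V-length B h)) , refl , h
⟦⟧V-++⁻ (L ∷ A) B (e₁ , e₂ , γ , refl , h₁ , γ≈ , h₂) with ⟦⟧V-++⁻ A B h₂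
... | eA , eB , refl , hA , hB =
  e₁ ⊎E eA , eB , sym (⊎E-assoc e₁ eA eB) , (e₁ , eA , γ , refl , h₁ , γ≈ , hA) , hB

⟦⟧V-++⁺ : ∀ A B {xs eA eB} → ⟦ A ⟧V xs eA → ⟦ B ⟧V xs eB → ⟦ A ++ B ⟧V xs (eA ⊎E eB)
⟦⟧V-++⁺ []      B {eB = eB} refl hB = subst (⟦ B ⟧V _) (sym (⊎E-emptyEnvˡ eB (⟦⟧V-length B hB))) hB
⟦⟧V-++⁺ (L ∷ A) B {eB = eB} (e₁ , e₂ , γ , refl , h₁ , γ≈ , h₂) hB =
  e₁ , e₂ ⊎E eB , γ , ⊎E-assoc e₁ e₂ eB , h₁ , γ≈ , ⟦⟧V-++⁺ A B h₂ hB

⊑V-infix : ∀ Ls₁ {K Q Ls₂ xs} → (∀ {e} → ⟦ K ∷ Ls₂ ⟧V xs e → ⟦ Q ++ Ls₂ ⟧V xs e) →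
  ⟦ Ls₁ ++ K ∷ Ls₂ ⟧V xs ⊑V ⟦ Ls₁ ++ Q ++ Ls₂ ⟧V xs
⊑V-infix Ls₁ {K} {Q} {Ls₂} f e _ h with ⟦⟧V-++⁻ Ls₁ (K ∷ Ls₂) h
... | e₁ , e₂ , refl , h₁ , h₂ = near {test} (⟦⟧V-++⁺ Ls₁ (Q ++ Ls₂) h₁ (f h₂))

⊑V-infix⁻ : ∀ Ls₁ {K Q Ls₂ xs} → (∀ {e} → ⟦ Q ++ Ls₂ ⟧V xs e → ⟦ K ∷ Ls₂ ⟧V xs e) →
  ⟦ Ls₁ ++ Q ++ Ls₂ ⟧V xs ⊑V ⟦ Ls₁ ++ K ∷ Ls₂ ⟧V xs
⊑V-infix⁻ Ls₁ {K} {Q} {Ls₂} f e _ h with ⟦⟧V-++⁻ Ls₁ (Q ++ Ls₂) h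
... | e₁ , e₂ , refl , h₁ , h₂ = near {test} (⟦⟧V-++⁺ Ls₁ (K ∷ Ls₂) h₁ (f h₂))

-- A value of λx.M is ≈ ⋆ only if x receives the empty multiset.
⟦lam∷⟧⇒⟦erase∷⟧ : ∀ M Ls₂ {xs e} → ⟦ lam M ∷ Ls₂ ⟧V xs e →
  lowerT 0 M ∈ erase 0 M × ⟦ lowerT 0 M ∷ Ls₂ ⟧V xs e
⟦lam∷⟧⇒⟦erase∷⟧ M Ls₂ (e₁ , e₂ , _ , refl , (_ , as , refl , hM) , seq (padR as≈) , h₂) =
  let m , h = ⟦erase⟧⁺ M (⟦⟧T-length-under-λ M hM) hM
  in m , (e₁ , e₂ , seq as , refl , h , seq as≈ , h₂)

⟦erase∷⟧⇒⟦lam∷⟧ : ∀ M Ls₂ {N xs e} → N ∈ erase 0 M → ⟦ N ∷ Ls₂ ⟧V xs e → ⟦ lam M ∷ Ls₂ ⟧V xs e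
⟦erase∷⟧⇒⟦lam∷⟧ M Ls₂ m (e₁ , e₂ , seq as , refl , h , seq as≈ , h₂) =
  e₁ , e₂ , seq ([] ∷ as) , refl , ([] , as , refl , ⟦erase⟧⁻ M m h) , seq (padR as≈) , h₂

⟦τλ⟧⁺ : ∀ Ls₁ M Ls₂ {xs} →
  ⟦ Ls₁ ++ lam M ∷ Ls₂ ⟧V xs ⊑V ⟦ map (λ N → Ls₁ ++ N ∷ Ls₂) (erase 0 M) ⟧VΣ xs
⟦τλ⟧⁺ Ls₁ M Ls₂ e _ h with ⟦⟧V-++⁻ Ls₁ (lam M ∷ Ls₂) h
... | e₁ , e₂ , refl , h₁ , h₂ =
  let m , h₂′ = ⟦lam∷⟧⇒⟦erase∷⟧ M Ls₂ h₂
  in near {test} (lose (∈-map⁺ (λ N → Ls₁ ++ N ∷ Ls₂) m) (⟦⟧V-++⁺ Ls₁ (lowerT 0 M ∷ Ls₂) h₁ h₂′))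

⟦τλ⟧⁻ : ∀ Ls₁ M Ls₂ {xs} →
  ⟦ map (λ N → Ls₁ ++ N ∷ Ls₂) (erase 0 M) ⟧VΣ xs ⊑V ⟦ Ls₁ ++ lam M ∷ Ls₂ ⟧V xs
⟦τλ⟧⁻ Ls₁ M Ls₂ e _ h with find h
... | V , v , hV with ∈-map⁻ (λ N → Ls₁ ++ N ∷ Ls₂) v
... | N , m , refl = ⊑V-infix⁻ Ls₁ {Q = [ N ]} (⟦erase∷⟧⇒⟦lam∷⟧ M Ls₂ m) e tt hV

⟦tst∷⟧⇒⟦++⟧ : ∀ V Ls₂ {xs e} → ⟦ tst V ∷ Ls₂ ⟧V xs e → ⟦ V ++ Ls₂ ⟧V xs e
⟦tst∷⟧⇒⟦++⟧ V Ls₂ (e₁ , e₂ , _ , refl , (hV , refl) , _ , h₂) = ⟦⟧V-++⁺ V Ls₂ hV h₂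

⟦++⟧⇒⟦tst∷⟧ : ∀ V Ls₂ {xs e} → ⟦ V ++ Ls₂ ⟧V xs e → ⟦ tst V ∷ Ls₂ ⟧V xs e
⟦++⟧⇒⟦tst∷⟧ V Ls₂ h with ⟦⟧V-++⁻ V Ls₂ h
... | eV , e₂ , refl , hV , h₂ = eV , e₂ , star , refl , (hV , refl) , ≈D-refl star , h₂

-- Contexts and structural equivalence

-- f is a one-hole context: every point of f A contains a point of A, and any point
-- near that one, of any A′, can be plugged back to give a point near the original.
record Frame {s t : Sort} (f : Ex s → Ex t) : Set where
  constructor frame
  field
    focus : ∀ {A xs e p} → ⟦_⟧ {t} (f A) xs e p →
      Σ (List ℕ) λ xs′ → Σ Env λ e′ → Σ (Pt s) λ p′ → ⟦_⟧ {s} A xs′ e′ p′ ×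
        (∀ {A′} → Near {s} (⟦ A′ ⟧ xs′) e′ p′ → Near {t} (⟦ f A′ ⟧ xs) e p)
open Frame

Frame-⊑ : ∀ {s t} {f : Ex s → Ex t} {A A′} → Frame f →
  (∀ xs → ⟦_⟧ {s} A xs ⊑ ⟦ A′ ⟧ xs) → ∀ xs → ⟦ f A ⟧ xs ⊑ ⟦ f A′ ⟧ xs
Frame-⊑ F A⊑A′ xs e p h with focus F h
... | xs′ , e′ , p′ , hA , plug = plug (A⊑A′ xs′ e′ p′ hA)

lam-frame : Frame {term} {term} lam
lam-frame = frame λ { (b , as , refl , h) → _ , _ , seq as , h , λ {M′} → Near-lam M′ }

appˡ-frame : ∀ P → Frame {term} {term} (λ M → app M P)
appˡ-frame P = frame λ { (e₁ , e₂ , b , γ , refl , h₁ , γ≈ , h₂) →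
  _ , e₁ , γ , h₁ , λ {M′} near → Near-appˡ M′ P near γ≈ h₂ }

appʳ-frame : ∀ M → Frame {bag} {term} (app M)
appʳ-frame M = frame λ { (e₁ , e₂ , b , γ , refl , h₁ , γ≈ , h₂) →
  _ , e₂ , b , h₂ , λ {P′} → Near-appʳ M P′ h₁ γ≈ }

tst-frame : Frame {test} {term} tst
tst-frame = frame λ { (hV , refl) →
  _ , _ , tt , hV , λ { (e′ , _ , e≈ , _ , h) → e′ , star , e≈ , ≈D-refl star , (h , refl) } }

bag-hd-frame : ∀ Ls → Frame {term} {bag} (_∷ Ls)
bag-hd-frame Ls = frame λ { (e₁ , e₂ , b , bs , refl , refl , h₁ , h₂) →
  _ , e₁ , b , h₁ , λ {L′} near → Near-∷ˡ L′ Ls near h₂ }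

bag-tl-frame : ∀ L → Frame {bag} {bag} (L ∷_)
bag-tl-frame L = frame λ { (e₁ , e₂ , b , bs , refl , refl , h₁ , h₂) →
  _ , e₂ , bs , h₂ , λ {Ls′} → Near-∷ʳ L Ls′ h₁ }

test-hd-frame : ∀ Ls → Frame {term} {test} (_∷ Ls)
test-hd-frame Ls = frame λ { (e₁ , e₂ , γ , refl , h₁ , γ≈⋆ , h₂) →
  _ , e₁ , γ , h₁ , λ { (e₁′ , γ′ , e≈ , γ≈ , h₁′) →
    e₁′ ⊎E e₂ , tt , ⊎E-cong e≈ ≈E-refl , tt ,
    (e₁′ , e₂ , γ′ , refl , h₁′ , ≈D-trans (≈D-sym γ≈) γ≈⋆ , h₂) } }

test-tl-frame : ∀ L → Frame {test} {test} (L ∷_)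
test-tl-frame L = frame λ { (e₁ , e₂ , γ , refl , h₁ , γ≈⋆ , h₂) →
  _ , e₂ , tt , h₂ , λ { (e₂′ , _ , e≈ , _ , h₂′) →
    e₁ ⊎E e₂′ , tt , ⊎E-cong ≈E-refl e≈ , tt , (e₁ , e₂′ , γ , refl , h₁ , γ≈⋆ , h₂′) } }

_⊑Σ_ : {s : Sort} → Sum s → Sum s → Set
_⊑Σ_ {s} S T = ∀ xs → ⟦ S ⟧Σ xs ⊑ ⟦ T ⟧Σ xs

_≈ᴵ_ : {s : Sort} → Sum s → Sum s → Set
_≈ᴵ_ {s} S T = _⊑Σ_ {s} S T × _⊑Σ_ {s} T S

⊑Σ-refl : ∀ {s} {S : Sum s} → _⊑Σ_ {s} S S
⊑Σ-refl _ = ⊑-refl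

⊑Σ-trans : ∀ {s} {S T U : Sum s} → _⊑Σ_ {s} S T → _⊑Σ_ {s} T U → _⊑Σ_ {s} S U
⊑Σ-trans S⊑T T⊑U xs = ⊑-trans (S⊑T xs) (T⊑U xs)

⊑Σ-++ : ∀ {s} {S S′ T T′ : Sum s} → _⊑Σ_ {s} S S′ → _⊑Σ_ {s} T T′ → _⊑Σ_ {s} (S ++ T) (S′ ++ T′)
⊑Σ-++ {S = S} {S′} S⊑S′ T⊑T′ xs e p h with Any.++⁻ S h
... | inj₁ hS = Near-map Any.++⁺ˡ (S⊑S′ xs e p hS)
... | inj₂ hT = Near-map (Any.++⁺ʳ S′) (T⊑T′ xs e p hT)

⊑Σ-[] : ∀ {s} {S : Sum s} → _⊑Σ_ {s} [] S
⊑Σ-[] _ _ _ ()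

⊑Σ-[_]⁺ : ∀ {s} {A : Ex s} {S} → (∀ xs → ⟦ A ⟧ xs ⊑ ⟦ S ⟧Σ xs) → _⊑Σ_ {s} [ A ] S
⊑Σ-[ A⊑S ]⁺ xs e p (here h) = A⊑S xs e p h

⊑Σ-[_]⁻ : ∀ {s} {A : Ex s} {S} → (∀ xs → ⟦ S ⟧Σ xs ⊑ ⟦ A ⟧ xs) → _⊑Σ_ {s} S [ A ]
⊑Σ-[ S⊑A ]⁻ xs e p h = Near-map here (S⊑A xs e p h)

⊑Σ-[_] : ∀ {s} {A B : Ex s} → (∀ xs → ⟦ A ⟧ xs ⊑ ⟦ B ⟧ xs) → _⊑Σ_ {s} [ A ] [ B ]
⊑Σ-[ A⊑B ] = ⊑Σ-[ (λ xs e p h → Near-map here (A⊑B xs e p h)) ]⁺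

Frame-⊑Σ : ∀ {s t} {f : Ex s → Ex t} {S T} → Frame f → _⊑Σ_ {s} S T → _⊑Σ_ {t} (map f S) (map f T)
Frame-⊑Σ {f = f} {S} F S⊑T xs e p h with find h
... | X , x∈ , hX with ∈-map⁻ f x∈
... | A , a∈ , refl with focus F hX
... | xs′ , e′ , p′ , hA , plug with Near-find (S⊑T xs′ e′ p′ (lose a∈ hA))
... | A′ , a′∈ , near = Near-lose (∈-map⁺ f a′∈) (plug near)

Frame-≈ᴵ : ∀ {s t} {f : Ex s → Ex t} {S T} → Frame f → _≈ᴵ_ {s} S T → _≈ᴵ_ {t} (map f S) (map f T)
Frame-≈ᴵ F (S⊑T , T⊑S) = Frame-⊑Σ F S⊑T , Frame-⊑Σ F T⊑S

⊑B⇒⊑V : ∀ V W {xs} → ⟦ V ⟧B xs ⊑B ⟦ W ⟧B xs → ⟦ V ⟧V xs ⊑V ⟦ W ⟧V xs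
⊑B⇒⊑V V W V⊑W e _ h with ⟦⟧V⇒⟦⟧B V h
... | b , hb , ⋆s with V⊑W e b hb
... | e′ , b′ , e≈ , b≈ , hW = e′ , tt , e≈ , tt , ⟦⟧B⇒⟦⟧V W hW (IsStar-resp-≈M (≈M-sym b≈) ⋆s)

⟦⟧B-swap : ∀ K J Ks {xs} → ⟦ K ∷ J ∷ Ks ⟧B xs ⊑B ⟦ J ∷ K ∷ Ks ⟧B xs
⟦⟧B-swap K J Ks _ _ (e₁ , _ , b , _ , refl , refl , hK , (f₁ , f₂ , c , cs , refl , refl , hJ , h)) =
  f₁ ⊎E (e₁ ⊎E f₂) , c ∷ b ∷ cs , ⊎E-swapˡ e₁ f₁ f₂ , ≈M-swap b c cs ,
  (f₁ , e₁ ⊎E f₂ , c , b ∷ cs , refl , refl , hJ , (e₁ , f₂ , b , cs , refl , refl , hK , h))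

⟦⟧B-insert : ∀ Ks₁ K Ks₂ xs → ⟦ K ∷ Ks₁ ++ Ks₂ ⟧B xs ⊑B ⟦ Ks₁ ++ K ∷ Ks₂ ⟧B xs
⟦⟧B-insert []        K Ks₂ xs = ⊑-refl
⟦⟧B-insert (J ∷ Ks₁) K Ks₂ xs =
  ⊑-trans (⟦⟧B-swap K J (Ks₁ ++ Ks₂))
    (Frame-⊑ {A = K ∷ Ks₁ ++ Ks₂} {Ks₁ ++ K ∷ Ks₂} (bag-tl-frame J) (⟦⟧B-insert Ks₁ K Ks₂) xs)

⟦⟧B-remove : ∀ Ks₁ K Ks₂ xs → ⟦ Ks₁ ++ K ∷ Ks₂ ⟧B xs ⊑B ⟦ K ∷ Ks₁ ++ Ks₂ ⟧B xs
⟦⟧B-remove []        K Ks₂ xs = ⊑-refl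
⟦⟧B-remove (J ∷ Ks₁) K Ks₂ xs =
  ⊑-trans (Frame-⊑ {A = Ks₁ ++ K ∷ Ks₂} {K ∷ Ks₁ ++ Ks₂} (bag-tl-frame J) (⟦⟧B-remove Ks₁ K Ks₂) xs)
    (⟦⟧B-swap J K (Ks₁ ++ Ks₂))

mutual
  ≅T-⊑ : ∀ {M M′} → M ≅T M′ → ∀ xs → ⟦ M ⟧T xs ⊑T ⟦ M′ ⟧T xs
  ≅T-⊑ var       xs = ⊑-refl
  ≅T-⊑ (lam p)   xs = Frame-⊑ lam-frame (≅T-⊑ p) xs
  ≅T-⊑ (app p q) xs = ⊑-trans (Frame-⊑ (appˡ-frame _) (≅T-⊑ p) xs) (Frame-⊑ (appʳ-frame _) (≅L-⊑ q) xs)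
  ≅T-⊑ (tst q)   xs = Frame-⊑ tst-frame (λ xs′ → ⊑B⇒⊑V _ _ (≅L-⊑ q xs′)) xs

  ≅L-⊑ : ∀ {P P′} → P ≅L P′ → ∀ xs → ⟦ P ⟧B xs ⊑B ⟦ P′ ⟧B xs
  ≅L-⊑ []                                   xs = ⊑-refl
  ≅L-⊑ (pick {K = K} {Ks₁} {Ks₂} refl p q) xs =
    ⊑-trans (Frame-⊑ (bag-hd-frame _) (≅T-⊑ p) xs)
      (⊑-trans (Frame-⊑ (bag-tl-frame K) (≅L-⊑ q) xs) (⟦⟧B-insert Ks₁ K Ks₂ xs))

mutual
  ≅T-⊒ : ∀ {M M′} → M ≅T M′ → ∀ xs → ⟦ M′ ⟧T xs ⊑T ⟦ M ⟧T xs
  ≅T-⊒ var       xs = ⊑-refl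
  ≅T-⊒ (lam p)   xs = Frame-⊑ lam-frame (≅T-⊒ p) xs
  ≅T-⊒ (app p q) xs = ⊑-trans (Frame-⊑ (appˡ-frame _) (≅T-⊒ p) xs) (Frame-⊑ (appʳ-frame _) (≅L-⊒ q) xs)
  ≅T-⊒ (tst q)   xs = Frame-⊑ tst-frame (λ xs′ → ⊑B⇒⊑V _ _ (≅L-⊒ q xs′)) xs

  ≅L-⊒ : ∀ {P P′} → P ≅L P′ → ∀ xs → ⟦ P′ ⟧B xs ⊑B ⟦ P ⟧B xs
  ≅L-⊒ []                                   xs = ⊑-refl
  ≅L-⊒ (pick {K = K} {Ks₁} {Ks₂} refl p q) xs =
    ⊑-trans (⟦⟧B-remove Ks₁ K Ks₂ xs)
      (⊑-trans (Frame-⊑ (bag-tl-frame K) (≅L-⊒ q) xs) (Frame-⊑ (bag-hd-frame _) (≅T-⊒ p) xs))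

≅-⊑ : ∀ {s} {A B : Ex s} → _≅_ {s} A B → ∀ xs → ⟦ A ⟧ xs ⊑ ⟦ B ⟧ xs
≅-⊑ {term} p = ≅T-⊑ p
≅-⊑ {bag}  p = ≅L-⊑ p
≅-⊑ {test} p xs = ⊑B⇒⊑V _ _ (≅L-⊑ p xs)

≅-⊒ : ∀ {s} {A B : Ex s} → _≅_ {s} A B → ∀ xs → ⟦ B ⟧ xs ⊑ ⟦ A ⟧ xs
≅-⊒ {term} p = ≅T-⊒ p
≅-⊒ {bag}  p = ≅L-⊒ p
≅-⊒ {test} p xs = ⊑B⇒⊑V _ _ (≅L-⊒ p xs)

≈Σ⇒≈ᴵ : ∀ {s} {S T : Sum s} → _≈Σ_ {s} S T → _≈ᴵ_ {s} S T
≈Σ⇒≈ᴵ {s} (S→T , T→S) = sim S→T (≅-⊑ {s}) , sim T→S (≅-⊒ {s})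
  where
  sim : ∀ {S T : Sum s} {R : Ex s → Ex s → Set} → (∀ {A} → A ∈ S → Σ (Ex s) λ B → B ∈ T × R A B) →
        (∀ {A B} → R A B → ∀ xs → ⟦ A ⟧ xs ⊑ ⟦ B ⟧ xs) → _⊑Σ_ {s} S T
  sim match R⊑ xs e p h with find h
  ... | A , a∈ , hA with match a∈
  ... | B , b∈ , r = Near-lose b∈ (R⊑ r xs e p hA)

mutual
  ⟶T-≈ᴵ : ∀ {M S} → M ⟶T S → _≈ᴵ_ {term} [ M ] S
  ⟶T-≈ᴵ (β {M} {P})           = ⊑Σ-[ (λ _ → ⟦β⟧⁺ M P) ]⁺ , ⊑Σ-[ (λ _ → ⟦β⟧⁻ M P) ]⁻
  ⟶T-≈ᴵ (τ[] {V})             = ⊑Σ-[ (λ _ → ⟦τ[]⟧⁺ V) ]⁺ , ⊑Σ-[ (λ _ → ⟦τ[]⟧⁻ V) ]⁻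
  ⟶T-≈ᴵ (τ∷ {V} {L} {Ls})     = ⊑Σ-[ (λ _ → ⟦τ∷⟧⁺ V L Ls) ]⁺ , ⊑Σ-[]
  ⟶T-≈ᴵ (lamC r)              = Frame-≈ᴵ lam-frame (⟶T-≈ᴵ r)
  ⟶T-≈ᴵ (appL {P = P} r)      = Frame-≈ᴵ (appˡ-frame P) (⟶T-≈ᴵ r)
  ⟶T-≈ᴵ (appR {M = M} r)      = Frame-≈ᴵ (appʳ-frame M) (⟶B-≈ᴵ r)
  ⟶T-≈ᴵ (tstC r)              = Frame-≈ᴵ tst-frame (⟶V-≈ᴵ r)

  ⟶B-≈ᴵ : ∀ {P S} → P ⟶B S → _≈ᴵ_ {bag} [ P ] S
  ⟶B-≈ᴵ (hd {Ls = Ls} r) = Frame-≈ᴵ (bag-hd-frame Ls) (⟶T-≈ᴵ r)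
  ⟶B-≈ᴵ (tl {L = L} r)   = Frame-≈ᴵ (bag-tl-frame L) (⟶B-≈ᴵ r)

  ⟶V-≈ᴵ : ∀ {V S} → V ⟶V S → _≈ᴵ_ {test} [ V ] S
  ⟶V-≈ᴵ (τλ {Ls₁} {M} {Ls₂}) = ⊑Σ-[ (λ _ → ⟦τλ⟧⁺ Ls₁ M Ls₂) ]⁺ , ⊑Σ-[ (λ _ → ⟦τλ⟧⁻ Ls₁ M Ls₂) ]⁻
  ⟶V-≈ᴵ (ττ {Ls₁} {V} {Ls₂}) =
    ⊑Σ-[ (λ _ → ⊑V-infix Ls₁ {tst V} {V} (⟦tst∷⟧⇒⟦++⟧ V Ls₂)) ] ,
    ⊑Σ-[ (λ _ → ⊑V-infix⁻ Ls₁ {tst V} {V} (⟦++⟧⇒⟦tst∷⟧ V Ls₂)) ]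
  ⟶V-≈ᴵ (hd {Ls = Ls} r) = Frame-≈ᴵ (test-hd-frame Ls) (⟶T-≈ᴵ r)
  ⟶V-≈ᴵ (tl {L = L} r)   = Frame-≈ᴵ (test-tl-frame L) (⟶V-≈ᴵ r)

Red-≈ᴵ : ∀ {s} {A : Ex s} {R} → Red s A R → _≈ᴵ_ {s} [ A ] R
Red-≈ᴵ {term} = ⟶T-≈ᴵ
Red-≈ᴵ {bag}  = ⟶B-≈ᴵ
Red-≈ᴵ {test} = ⟶V-≈ᴵ

Step-≈ᴵ : ∀ {s} {S T} → Step s S T → _≈ᴵ_ {s} S T
Step-≈ᴵ {s} (red {S1} {A} {S2} {R} r) =
  ⊑Σ-++ {S = S1} (⊑Σ-refl {s} {S1}) (⊑Σ-++ {S = [ A ]} (proj₁ (Red-≈ᴵ r)) (⊑Σ-refl {s} {S2})) ,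
  ⊑Σ-++ {S = S1} (⊑Σ-refl {s} {S1}) (⊑Σ-++ {S = R} (proj₂ (Red-≈ᴵ r)) (⊑Σ-refl {s} {S2}))
Step-≈ᴵ (eqv S≈T) = ≈Σ⇒≈ᴵ S≈T

↠-≈ᴵ : ∀ {s} {S T} → _↠_ {s} S T → _≈ᴵ_ {s} S T
↠-≈ᴵ {s} ε            = ⊑Σ-refl {s} , ⊑Σ-refl {s}
↠-≈ᴵ {s} (step ◅ steps) with Step-≈ᴵ step | ↠-≈ᴵ steps
... | S⊑T , T⊑S | T⊑U , U⊑T = ⊑Σ-trans {s} S⊑T T⊑U , ⊑Σ-trans {s} U⊑T T⊑S

theorem4p12 : (s : Sort) (A B : Sum s) (xs : List ℕ) → Unique xs →
              (∀ i → FreeΣ s i A → i ∈ xs) →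
              _↠_ {s} A B → _≐_ {s} (⟦ A ⟧Σ xs) (⟦ B ⟧Σ xs)
theorem4p12 s A B xs _ _ A↠B = proj₁ (↠-≈ᴵ A↠B) xs , proj₂ (↠-≈ᴵ A↠B) xs
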